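{- Let $q$ and $q+2$ be prime powers with $q\equiv3\pmod 4$, and let $E$ be a skew Hadamard difference set in $(\mathbb{F}_q,+)$. Let $\chi$ be the quadratic character of $\mathbb{F}_{q+2}^*$. Then the set $$D=\{(x,y)\mid x\in E,\ y\in\mathbb{F}_{q+2}^*,\ \chi(y)=1\}\cup\{(x,y)\mid x\in -E,\ y\in\mathbb{F}_{q+2}^*,\ \chi(y)=-1\}\cup\{(x,0)\mid x\in\mathbb{F}_q\}$$ is a $(4n-1,2n-1,n-1)$ difference set in $(\mathbb{F}_q,+)\times(\mathbb{F}_{q+2},+)$, where $n=\frac{(q+1)^2}{4}$.
   Context: A $k$-subset $D$ of a finite abelian group $G$ (written additively) of order $v$ is a $(v,k,\lambda)$ difference set if every nonzero element of $G$ is represented exactly $\lambda$ times as $x-y$ with $x,y\in D$, $x\ne y$. A difference set $E$ in $(\mathbb{F}_q,+)$ is skew Hadamard if $\mathbb{F}_q$ is the disjoint union of $E$, $-E$ and $\{0\}$. -}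

module Defs where

open import Level using (0ℓ)
open import Data.Nat using (ℕ; _≤_)
open import Data.Nat.Primality using (Prime)
open import Data.Integer using (ℤ; 0ℤ; 1ℤ; -1ℤ)
open import Data.Product using (Σ; ∃; _×_; _,_; proj₁; proj₂)
open import Data.Sum using (_⊎_)
open import Data.Empty using (⊥)
open import Data.List using (List; length)
open import Data.List.Membership.Propositional using (_∈_)
open import Data.List.Relation.Unary.Unique.Propositional using (Unique)
open import Data.List.Relation.Unary.Any using (Any; any?)
open import Relation.Nullary using (¬_; Dec; yes; no)
open import Relation.Binary.PropositionalEquality using (_≡_; _≢_)
open import Relation.Binary.Definitions using (DecidableEquality)
open import Function.Bundles using (_⇔_)
import Algebra.Structures as AS

IsPrimePower : ℕ → Set
IsPrimePower q = Σ ℕ λ p → Σ ℕ λ m → Prime p × 1 ≤ m × q ≡ p Data.Nat.^ m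

HasSize : {A : Set} → (A → Set) → ℕ → Set
HasSize {A} P k = Σ (List A) λ xs → Unique xs × (∀ a → (a ∈ xs) ⇔ P a) × length xs ≡ k

record FiniteField : Set₁ where
  infixl 7 _*_
  infixl 6 _+_
  field
    Carrier : Set
    _+_ _*_ : Carrier → Carrier → Carrier
    -_      : Carrier → Carrier
    0# 1#   : Carrier
    isCommutativeRing : AS.IsCommutativeRing {A = Carrier} _≡_ _+_ _*_ -_ 0# 1#
    0≢1     : 0# ≢ 1#
    inverse : ∀ x → x ≢ 0# → Σ Carrier λ y → x * y ≡ 1#
    _≟_     : DecidableEquality Carrier
    elements : List Carrier
    elements-unique : Unique elements
    elements-complete : ∀ x → x ∈ elements

  size : ℕ
  size = length elements

  _-_ : Carrier → Carrier → Carrier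
  x - y = x + (- y)

  IsSquare : Carrier → Set
  IsSquare y = Σ Carrier λ z → z * z ≡ y

  χ : Carrier → ℤ
  χ y with y ≟ 0#
  ... | yes _ = 0ℤ
  ... | no _ with any? (λ z → (z * z) ≟ y) elements
  ...   | yes _ = 1ℤ
  ...   | no _ = -1ℤ

open FiniteField public using (Carrier)

IsDifferenceSet : {A : Set} → (_-_ : A → A → A) → (zero : A) →
                  (D : A → Set) → (v k λ′ : ℕ) → Set
IsDifferenceSet {A} _-_ zero D v k λ′ =
  HasSize (λ (_ : A) → Data.Unit.⊤) v × HasSize D k ×
  (∀ g → g ≢ zero →
     HasSize (λ (p : A × A) → D (proj₁ p) × D (proj₂ p) × proj₁ p ≢ proj₂ p
                               × (proj₁ p - proj₂ p) ≡ g) λ′)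
  where import Data.Unit

NegSet : (F : FiniteField) → (Carrier F → Set) → Carrier F → Set
NegSet F E x = Σ (Carrier F) λ e → E e × x ≡ FiniteField.-_ F e

IsSkewHadamard : (F : FiniteField) → (Carrier F → Set) → Set
IsSkewHadamard F E =
  (Σ ℕ λ k → Σ ℕ λ λ′ → IsDifferenceSet _-_ 0# E size k λ′) ×
  (∀ x → (E x ⊎ NegSet F E x ⊎ x ≡ 0#)) ×
  (∀ x → ¬ (E x × NegSet F E x)) ×
  (∀ x → ¬ (E x × x ≡ 0#)) ×
  (∀ x → ¬ (NegSet F E x × x ≡ 0#))
  where open FiniteField F

prodSub : (F K : FiniteField) → Carrier F × Carrier K → Carrier F × Carrier K → Carrier F × Carrier K
prodSub F K (x , y) (x′ , y′) = FiniteField._-_ F x x′ , FiniteField._-_ K y y′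

prodZero : (F K : FiniteField) → Carrier F × Carrier K
prodZero F K = FiniteField.0# F , FiniteField.0# K

Dset : (F K : FiniteField) → (Carrier F → Set) → Carrier F × Carrier K → Set
Dset F K E (x , y) =
  (E x × y ≢ FiniteField.0# K × FiniteField.χ K y ≡ 1ℤ) ⊎
  (NegSet F E x × y ≢ FiniteField.0# K × FiniteField.χ K y ≡ -1ℤ) ⊎
  (y ≡ FiniteField.0# K)

{-# OPTIONS --safe #-}
-- Write s = 2·1_D − 1 for the ±1 function of D, ψ = 1_E − 1_{−E} on F, and χ for the quadratic
-- character of K. A k-subset of a group of order v is a (v, k, λ) difference set exactly when its ±1
-- function has autocorrelation 4λ − 4k + v at every nonzero shift. Pointwise
-- s(x, y) = δ(y) + δ(x)(δ(y) − 1) + ψ(x)χ(y), so the autocorrelation of s is a sum of products of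
-- autocorrelations on F and on K, and all of these are explicit: ψ is odd with autocorrelation |F|δ − 1
-- because E is a skew Hadamard difference set, and χ is even (−1 is a square as |K| ≡ 1 mod 4) with
-- autocorrelation |K|δ − 1, by counting the solutions of z² = w² + b. Hence s has autocorrelation −1
-- off the origin and sum −1, which gives k = 2n − 1 and λ = n − 1.
module Submission where

open import Defs
open import Level using (0ℓ)
open import Data.Integer using (ℤ; +_; -[1+_]; 0ℤ; 1ℤ; -1ℤ; NonZero)
import Data.Integer.Properties as ℤ
open import Data.Integer.Tactic.RingSolver using (solve-∀)
open import Data.Nat using (ℕ; suc)
import Data.Nat as ℕ
import Data.Nat.Properties as ℕ
import Data.Nat.Tactic.RingSolver as ℕ-Solver
open import Data.Nat.DivMod using (m*n/n≡m)
open import Data.Fin using (Fin)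
import Data.Fin.Properties as Fin
open import Data.List using (List; []; _∷_; _++_; map; filter; length; cartesianProduct; lookup)
open import Data.List.Membership.Propositional using (_∈_; lose)
open import Data.List.Membership.Propositional.Properties using (∈-map⁺; ∈-filter⁺; ∈-filter⁻; ∈-cartesianProduct⁺)
open import Data.List.Membership.Propositional.Properties.WithK using (unique∧set⇒bag)
open import Data.List.Membership.DecPropositional using (_∈?_)
open import Data.List.Relation.Unary.Any using (here; there; index; any?; satisfied)
open import Data.List.Relation.Unary.Any.Properties using (lookup-index)
import Data.List.Relation.Unary.All as All
open import Data.List.Relation.Unary.Unique.Propositional using (Unique; []; _∷_)
import Data.List.Relation.Unary.Unique.Propositional.Properties as Unique
open import Data.List.Relation.Binary.Permutation.Propositional as ↭ using (_↭_)
open import Data.List.Relation.Binary.Permutation.Propositional.Properties using (↭-length)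
open import Data.List.Relation.Binary.BagAndSetEquality using (∼bag⇒↭)
open import Data.Product using (∃; _×_; _,_; proj₁; proj₂)
open import Data.Product.Properties using (≡-dec)
open import Data.Sum using (_⊎_; inj₁; inj₂; [_,_]′)
open import Data.Unit using (tt)
open import Data.Empty using (⊥; ⊥-elim)
open import Function using (id; case_of_)
open import Function.Bundles using (_⇔_; mk⇔; Equivalence)
open import Relation.Nullary using (¬_; Dec; yes; no)
open import Relation.Nullary.Decidable using (map′; _×-dec_; _⊎-dec_; ¬?)
open import Relation.Unary using (Decidable)
open import Relation.Binary.Definitions using (DecidableEquality)
open import Relation.Binary.PropositionalEquality
  using (_≡_; _≢_; refl; sym; trans; cong; cong₂; subst; isEquivalence; module ≡-Reasoning)
open import Algebra.Bundles using (AbelianGroup; CommutativeRing)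
open import Algebra.Structures using (IsAbelianGroup; IsCommutativeRing)
import Algebra.Properties.AbelianGroup as AbelianGroupProperties
import Algebra.Properties.Ring as RingProperties
import Algebra.Properties.CommutativeSemigroup as CommutativeSemigroupProperties

module FiniteSums where

  open import Data.Integer using (_+_; _*_; -_; _-_)

  𝟙 : {P : Set} → Dec P → ℤ
  𝟙 (yes _) = 1ℤ
  𝟙 (no _)  = 0ℤ

  𝟙-yes : {P : Set} (d : Dec P) → P → 𝟙 d ≡ 1ℤ
  𝟙-yes (yes _) _ = refl
  𝟙-yes (no ¬p) p = ⊥-elim (¬p p)

  𝟙-no : {P : Set} (d : Dec P) → ¬ P → 𝟙 d ≡ 0ℤ
  𝟙-no (yes p) ¬p = ⊥-elim (¬p p)
  𝟙-no (no _)  _  = refl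

  𝟙-cong : {P Q : Set} (d : Dec P) (e : Dec Q) → P ⇔ Q → 𝟙 d ≡ 𝟙 e
  𝟙-cong (yes p) e       P⇔Q = sym (𝟙-yes e (Equivalence.to P⇔Q p))
  𝟙-cong (no ¬p) (yes q) P⇔Q = ⊥-elim (¬p (Equivalence.from P⇔Q q))
  𝟙-cong (no _)  (no _)  _   = refl

  𝟙-× : {P Q : Set} (d : Dec P) (e : Dec Q) → 𝟙 (d ×-dec e) ≡ 𝟙 d * 𝟙 e
  𝟙-× (yes _) (yes _) = refl
  𝟙-× (yes _) (no _)  = refl
  𝟙-× (no _)  _       = refl

  ∑ : {A : Set} → List A → (A → ℤ) → ℤ
  ∑ []       f = 0ℤ
  ∑ (x ∷ xs) f = f x + ∑ xs f

  module _ {A : Set} where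

    ∑-cong : ∀ xs {f g : A → ℤ} → (∀ x → f x ≡ g x) → ∑ xs f ≡ ∑ xs g
    ∑-cong []       f≗g = refl
    ∑-cong (x ∷ xs) f≗g = cong₂ _+_ (f≗g x) (∑-cong xs f≗g)

    ∑-zero : ∀ xs → ∑ xs (λ (_ : A) → 0ℤ) ≡ 0ℤ
    ∑-zero []       = refl
    ∑-zero (x ∷ xs) = trans (ℤ.+-identityˡ _) (∑-zero xs)

    ∑-+ : ∀ xs (f g : A → ℤ) → ∑ xs (λ x → f x + g x) ≡ ∑ xs f + ∑ xs g
    ∑-+ []       f g = refl
    ∑-+ (x ∷ xs) f g = trans (cong (_+_ (f x + g x)) (∑-+ xs f g)) (interchange (f x) (g x) _ _)
      where interchange : ∀ a b c d → a + b + (c + d) ≡ a + c + (b + d)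
            interchange = solve-∀

    ∑-*ˡ : ∀ xs c (f : A → ℤ) → ∑ xs (λ x → c * f x) ≡ c * ∑ xs f
    ∑-*ˡ []       c f = sym (ℤ.*-zeroʳ c)
    ∑-*ˡ (x ∷ xs) c f = trans (cong (_+_ (c * f x)) (∑-*ˡ xs c f)) (sym (ℤ.*-distribˡ-+ c (f x) _))

    ∑-*ʳ : ∀ xs c (f : A → ℤ) → ∑ xs (λ x → f x * c) ≡ ∑ xs f * c
    ∑-*ʳ xs c f = trans (∑-cong xs (λ x → ℤ.*-comm (f x) c)) (trans (∑-*ˡ xs c f) (ℤ.*-comm c _))

    ∑-neg : ∀ xs (f : A → ℤ) → ∑ xs (λ x → - f x) ≡ - ∑ xs f
    ∑-neg xs f = trans (∑-cong xs (λ x → sym (ℤ.-1*i≡-i (f x)))) (trans (∑-*ˡ xs -1ℤ f) (ℤ.-1*i≡-i _))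

    ∑-- : ∀ xs (f g : A → ℤ) → ∑ xs (λ x → f x - g x) ≡ ∑ xs f - ∑ xs g
    ∑-- xs f g = trans (∑-+ xs f (λ x → - g x)) (cong (_+_ (∑ xs f)) (∑-neg xs g))

    ∑-one : ∀ xs → ∑ xs (λ (_ : A) → 1ℤ) ≡ + length xs
    ∑-one []       = refl
    ∑-one (x ∷ xs) = trans (cong (_+_ 1ℤ) (∑-one xs)) (sym (ℤ.pos-+ 1 (length xs)))

    ∑-++ : ∀ xs ys (f : A → ℤ) → ∑ (xs ++ ys) f ≡ ∑ xs f + ∑ ys f
    ∑-++ []       ys f = sym (ℤ.+-identityˡ _)
    ∑-++ (x ∷ xs) ys f = trans (cong (_+_ (f x)) (∑-++ xs ys f)) (sym (ℤ.+-assoc (f x) _ _))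

    ∑-filter : ∀ {P : A → Set} (P? : Decidable P) xs → ∑ xs (λ x → 𝟙 (P? x)) ≡ + length (filter P? xs)
    ∑-filter P? []       = refl
    ∑-filter P? (x ∷ xs) with P? x
    ... | yes _ = trans (cong (_+_ 1ℤ) (∑-filter P? xs)) (sym (ℤ.pos-+ 1 _))
    ... | no _  = trans (ℤ.+-identityˡ _) (∑-filter P? xs)

    ∑-↭ : ∀ {xs ys} (f : A → ℤ) → xs ↭ ys → ∑ xs f ≡ ∑ ys f
    ∑-↭ f ↭.refl                  = refl
    ∑-↭ f (↭.prep x xs↭ys)        = cong (_+_ (f x)) (∑-↭ f xs↭ys)
    ∑-↭ f (↭.swap {xs} x y xs↭ys) = trans (sym (ℤ.+-assoc (f x) (f y) (∑ xs f)))
      (trans (cong₂ _+_ (ℤ.+-comm (f x) (f y)) (∑-↭ f xs↭ys)) (ℤ.+-assoc (f y) (f x) _))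
    ∑-↭ f (↭.trans p q)           = trans (∑-↭ f p) (∑-↭ f q)

  ∑-map : {A B : Set} (g : A → B) (xs : List A) (f : B → ℤ) → ∑ (map g xs) f ≡ ∑ xs (λ x → f (g x))
  ∑-map g []       f = refl
  ∑-map g (x ∷ xs) f = cong (_+_ (f (g x))) (∑-map g xs f)

  ∑-swap : {A B : Set} (xs : List A) (ys : List B) (f : A → B → ℤ) →
           ∑ xs (λ x → ∑ ys (λ y → f x y)) ≡ ∑ ys (λ y → ∑ xs (λ x → f x y))
  ∑-swap []       ys f = sym (∑-zero ys)
  ∑-swap (x ∷ xs) ys f = trans (cong (_+_ (∑ ys (f x))) (∑-swap xs ys f)) (sym (∑-+ ys (f x) _))

  ∑-cartesianProduct : {A B : Set} (xs : List A) (ys : List B) (f : A × B → ℤ) →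
                       ∑ (cartesianProduct xs ys) f ≡ ∑ xs (λ x → ∑ ys (λ y → f (x , y)))
  ∑-cartesianProduct []       ys f = refl
  ∑-cartesianProduct (x ∷ xs) ys f = trans (∑-++ (map (x ,_) ys) _ f)
    (cong₂ _+_ (∑-map (x ,_) ys f) (∑-cartesianProduct xs ys f))

  ∑-⊗ : {A B : Set} (xs : List A) (ys : List B) (f : A → ℤ) (g : B → ℤ) →
        ∑ xs (λ x → ∑ ys (λ y → f x * g y)) ≡ ∑ xs f * ∑ ys g
  ∑-⊗ xs ys f g = trans (∑-cong xs (λ x → ∑-*ˡ ys (f x) g)) (∑-*ʳ xs (∑ ys g) f)

  unique-↭ : {A : Set} {xs ys : List A} → Unique xs → Unique ys → (∀ x → x ∈ xs ⇔ x ∈ ys) → xs ↭ ys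
  unique-↭ uxs uys same = ∼bag⇒↭ (unique∧set⇒bag uxs uys (λ {x} → same x))

  record Finite (A : Set) : Set where
    infix 4 _≟_
    field
      _≟_               : DecidableEquality A
      elements          : List A
      elements-unique   : Unique elements
      elements-complete : ∀ x → x ∈ elements

    sum : (A → ℤ) → ℤ
    sum = ∑ elements

    size : ℕ
    size = length elements

  _×ᶠ_ : {A B : Set} → Finite A → Finite B → Finite (A × B)
  finA ×ᶠ finB = record
    { _≟_               = ≡-dec A._≟_ B._≟_
    ; elements          = cartesianProduct A.elements B.elements
    ; elements-unique   = Unique.cartesianProduct⁺ A.elements-unique B.elements-unique
    ; elements-complete = λ (x , y) → ∈-cartesianProduct⁺ (A.elements-complete x) (B.elements-complete y)
    }
    where module A = Finite finA
          module B = Finite finB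

  module FiniteSum {A : Set} (fin : Finite A) where
    open Finite fin public

    private
      ↭-elements : ∀ {xs} → Unique xs → (∀ x → x ∈ xs) → xs ↭ elements
      ↭-elements uxs cxs = unique-↭ uxs elements-unique (λ x → mk⇔ (λ _ → elements-complete x) (λ _ → cxs x))

    sum-size : sum (λ _ → 1ℤ) ≡ + size
    sum-size = ∑-one elements

    sum-reindex : (σ τ : A → A) → (∀ x → τ (σ x) ≡ x) → (∀ x → σ (τ x) ≡ x) →
                  ∀ (h : A → ℤ) → sum (λ x → h (σ x)) ≡ sum h
    sum-reindex σ τ τσ στ h = trans (sym (∑-map σ elements h))
      (∑-↭ h (↭-elements (Unique.map⁺ σ-injective elements-unique)
                         (λ x → subst (_∈ map σ elements) (στ x) (∈-map⁺ σ (elements-complete (τ x))))))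
      where σ-injective : ∀ {x y} → σ x ≡ σ y → x ≡ y
            σ-injective {x} {y} eq = trans (sym (τσ x)) (trans (cong τ eq) (τσ y))

    module _ {P : A → Set} (P? : Decidable P) where

      private
        filter-↭ : ∀ {k} → (hs : HasSize P k) → filter P? elements ↭ proj₁ hs
        filter-↭ (xs , uxs , xs⇔P , _) = unique-↭ (Unique.filter⁺ P? {elements} elements-unique) uxs
          (λ x → mk⇔ (λ x∈ → Equivalence.from (xs⇔P x) (proj₂ (∈-filter⁻ P? {xs = elements} x∈)))
                     (λ x∈ → ∈-filter⁺ P? (elements-complete x) (Equivalence.to (xs⇔P x) x∈)))

      sum-𝟙 : ∀ {k} → HasSize P k → sum (λ x → 𝟙 (P? x)) ≡ + k
      sum-𝟙 hs@(_ , _ , _ , len) = trans (∑-filter P? elements) (cong +_ (trans (↭-length (filter-↭ hs)) len))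

      hasSize : ∀ {k} → sum (λ x → 𝟙 (P? x)) ≡ + k → HasSize P k
      hasSize eq = filter P? elements , Unique.filter⁺ P? {elements} elements-unique ,
        (λ x → mk⇔ (λ x∈ → proj₂ (∈-filter⁻ P? {xs = elements} x∈)) (∈-filter⁺ P? (elements-complete x))) ,
        ℤ.+-injective (trans (sym (∑-filter P? elements)) eq)

    sum-point : ∀ a (h : A → ℤ) → sum (λ x → 𝟙 (x ≟ a) * h x) ≡ h a
    sum-point a h = begin
      sum (λ x → 𝟙 (x ≟ a) * h x) ≡⟨ ∑-cong elements pointwise ⟩
      sum (λ x → 𝟙 (x ≟ a) * h a) ≡⟨ ∑-*ʳ elements (h a) (λ x → 𝟙 (x ≟ a)) ⟩
      sum (λ x → 𝟙 (x ≟ a)) * h a ≡⟨ cong (_* h a) (sum-𝟙 (_≟ a) singleton) ⟩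
      1ℤ * h a                    ≡⟨ ℤ.*-identityˡ (h a) ⟩
      h a                         ∎
      where
        open ≡-Reasoning
        pointwise : ∀ x → 𝟙 (x ≟ a) * h x ≡ 𝟙 (x ≟ a) * h a
        pointwise x with x ≟ a
        ... | yes refl = refl
        ... | no _     = refl
        singleton : HasSize (_≡ a) 1
        singleton = a ∷ [] , All.[] ∷ [] , (λ x → mk⇔ (λ { (here eq) → eq ; (there ()) }) (λ eq → here eq)) , refl

    module _ (σ : A → A) (σ-involutive : ∀ x → σ (σ x) ≡ x) (p : A → ℤ) (p∘σ : ∀ x → p (σ x) ≡ p x) where

      private
        position : A → Fin size
        position x = index (elements-complete x)

        position-injective : ∀ {x y} → position x ≡ position y → x ≡ y
        position-injective {x} {y} eq = trans (lookup-index (elements-complete x))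
          (trans (cong (lookup elements) eq) (sym (lookup-index (elements-complete y))))

        before : A → ℤ
        before x = p x * 𝟙 (position x Fin.<? position (σ x))

        trichotomy : ∀ x → 𝟙 (σ x ≟ x) + 𝟙 (position x Fin.<? position (σ x)) + 𝟙 (position (σ x) Fin.<? position x) ≡ 1ℤ
        trichotomy x with σ x ≟ x | position x Fin.<? position (σ x) | position (σ x) Fin.<? position x
        ... | _        | yes lt | yes gt = ⊥-elim (Fin.<-asym lt gt)
        ... | yes σx≡x | yes lt | no _   = ⊥-elim (Fin.<-irrefl (cong position (sym σx≡x)) lt)
        ... | yes σx≡x | no _   | yes gt = ⊥-elim (Fin.<-irrefl (cong position σx≡x) gt)
        ... | yes _    | no _   | no _   = refl
        ... | no _     | yes _  | no _   = refl
        ... | no _     | no _   | yes _  = refl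
        ... | no σx≢x  | no ≮   | no ≯   = ⊥-elim (σx≢x (sym (position-injective (Fin.≤-antisym (ℕ.≮⇒≥ ≯) (ℕ.≮⇒≥ ≮)))))

        before-σ : ∀ x → before (σ x) ≡ p x * 𝟙 (position (σ x) Fin.<? position x)
        before-σ x rewrite σ-involutive x | p∘σ x = refl

        split : ∀ x → p x ≡ p x * 𝟙 (σ x ≟ x) + before x + before (σ x)
        split x = begin
          p x                                    ≡⟨ sym (ℤ.*-identityʳ (p x)) ⟩
          p x * 1ℤ                               ≡⟨ cong (p x *_) (sym (trichotomy x)) ⟩
          p x * (𝟙 (σ x ≟ x) + 𝟙 (position x Fin.<? position (σ x)) + 𝟙 (position (σ x) Fin.<? position x))
                                                 ≡⟨ distrib (p x) _ _ _ ⟩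
          p x * 𝟙 (σ x ≟ x) + before x + p x * 𝟙 (position (σ x) Fin.<? position x)
                                                 ≡⟨ cong (_+_ (p x * 𝟙 (σ x ≟ x) + before x)) (sym (before-σ x)) ⟩
          p x * 𝟙 (σ x ≟ x) + before x + before (σ x) ∎
          where open ≡-Reasoning
                distrib : ∀ a b c d → a * (b + c + d) ≡ a * b + a * c + a * d
                distrib = solve-∀

      -- A pair {x, σ x} with σ x ≢ x is counted once, through its member listed first in the enumeration.
      sum-involution : ∃ λ s → sum p ≡ sum (λ x → p x * 𝟙 (σ x ≟ x)) + + 2 * s
      sum-involution = sum before , (begin
        sum p                                                       ≡⟨ ∑-cong elements split ⟩
        sum (λ x → p x * 𝟙 (σ x ≟ x) + before x + before (σ x))     ≡⟨ ∑-+ elements _ (λ x → before (σ x)) ⟩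
        sum (λ x → p x * 𝟙 (σ x ≟ x) + before x) + sum (λ x → before (σ x))
                                                                    ≡⟨ cong₂ _+_ (∑-+ elements _ before) (sum-reindex σ σ σ-involutive σ-involutive before) ⟩
        sum (λ x → p x * 𝟙 (σ x ≟ x)) + sum before + sum before     ≡⟨ double (sum (λ x → p x * 𝟙 (σ x ≟ x))) (sum before) ⟩
        sum (λ x → p x * 𝟙 (σ x ≟ x)) + + 2 * sum before            ∎)
        where open ≡-Reasoning
              double : ∀ a b → a + b + b ≡ a + + 2 * b
              double = solve-∀

module Correlations where

  open import Data.Integer using (_+_; _*_; -_; _-_)
  open FiniteSums

  record FiniteAbelianGroup : Set₁ where
    infix  8 _⁻¹
    infixl 7 _∙_
    field
      Carrier        : Set
      _∙_            : Carrier → Carrier → Carrier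
      ε              : Carrier
      _⁻¹            : Carrier → Carrier
      isAbelianGroup : IsAbelianGroup _≡_ _∙_ ε _⁻¹
      finite         : Finite Carrier

    abelianGroup : AbelianGroup 0ℓ 0ℓ
    abelianGroup = record { isAbelianGroup = isAbelianGroup }

    open IsAbelianGroup isAbelianGroup public using (assoc; comm; identityˡ; identityʳ; inverseˡ; inverseʳ)
    open AbelianGroupProperties abelianGroup public
    open FiniteSum finite public

  _×ᴳ_ : FiniteAbelianGroup → FiniteAbelianGroup → FiniteAbelianGroup
  G ×ᴳ H = record
    { Carrier        = G.Carrier × H.Carrier
    ; _∙_            = _∙_
    ; ε              = G.ε , H.ε
    ; _⁻¹            = _⁻¹
    ; isAbelianGroup = record
      { isGroup = record
        { isMonoid = record
          { isSemigroup = record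
            { isMagma = record
              { isEquivalence = isEquivalence
              ; ∙-cong        = λ p q → cong₂ _∙_ p q
              }
            ; assoc = λ x y z → cong₂ _,_ (G.assoc _ _ _) (H.assoc _ _ _)
            }
          ; identity = (λ x → cong₂ _,_ (G.identityˡ _) (H.identityˡ _))
                     , (λ x → cong₂ _,_ (G.identityʳ _) (H.identityʳ _))
          }
        ; inverse = (λ x → cong₂ _,_ (G.inverseˡ _) (H.inverseˡ _))
                  , (λ x → cong₂ _,_ (G.inverseʳ _) (H.inverseʳ _))
        ; ⁻¹-cong = cong _⁻¹
        }
      ; comm = λ x y → cong₂ _,_ (G.comm _ _) (H.comm _ _)
      }
    ; finite         = G.finite ×ᶠ H.finite
    }
    where
      module G = FiniteAbelianGroup G
      module H = FiniteAbelianGroup H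
      _∙_ : G.Carrier × H.Carrier → G.Carrier × H.Carrier → G.Carrier × H.Carrier
      (x , y) ∙ (x′ , y′) = x G.∙ x′ , y H.∙ y′
      _⁻¹ : G.Carrier × H.Carrier → G.Carrier × H.Carrier
      (x , y) ⁻¹ = x G.⁻¹ , y H.⁻¹

  module Correlation (G : FiniteAbelianGroup) where
    open FiniteAbelianGroup G public renaming (Carrier to A)

    δ : A → ℤ
    δ x = 𝟙 (x ≟ ε)

    corr : (A → ℤ) → (A → ℤ) → A → ℤ
    corr u v a = sum (λ x → u x * v (x ∙ a ⁻¹))

    x∙[x∙a⁻¹]⁻¹≡a : ∀ x a → x ∙ (x ∙ a ⁻¹) ⁻¹ ≡ a
    x∙[x∙a⁻¹]⁻¹≡a x a = begin
      x ∙ (x ∙ a ⁻¹) ⁻¹ ≡⟨ cong (x ∙_) (⁻¹-anti-homo‿- x a) ⟩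
      x ∙ (a ∙ x ⁻¹)    ≡⟨ sym (assoc x a (x ⁻¹)) ⟩
      x ∙ a ∙ x ⁻¹      ≡⟨ xyx⁻¹≈y x a ⟩
      a                 ∎
      where open ≡-Reasoning

    sum-translate : ∀ a (h : A → ℤ) → sum (λ x → h (x ∙ a ⁻¹)) ≡ sum h
    sum-translate a = sum-reindex (λ x → x ∙ a ⁻¹) (λ x → x ∙ a) (//-rightDividesˡ a) (//-rightDividesʳ a)

    sum-translate⁻ : ∀ a (h : A → ℤ) → sum (λ x → h (x ∙ a)) ≡ sum h
    sum-translate⁻ a = sum-reindex (λ x → x ∙ a) (λ x → x ∙ a ⁻¹) (//-rightDividesʳ a) (//-rightDividesˡ a)

    sum-reflect : ∀ x (h : A → ℤ) → sum (λ a → h (x ∙ a ⁻¹)) ≡ sum h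
    sum-reflect x = sum-reindex (λ a → x ∙ a ⁻¹) (λ a → x ∙ a ⁻¹) (x∙[x∙a⁻¹]⁻¹≡a x) (x∙[x∙a⁻¹]⁻¹≡a x)

    sum-δ : sum δ ≡ 1ℤ
    sum-δ = trans (∑-cong elements (λ x → sym (ℤ.*-identityʳ (δ x)))) (sum-point ε (λ _ → 1ℤ))

    sum-inverse : ∀ (h : A → ℤ) → sum (λ x → h (x ⁻¹)) ≡ sum h
    sum-inverse = sum-reindex _⁻¹ _⁻¹ ⁻¹-involutive ⁻¹-involutive

    x∙ε⁻¹≡x : ∀ x → x ∙ ε ⁻¹ ≡ x
    x∙ε⁻¹≡x x = trans (cong (x ∙_) ε⁻¹≈ε) (identityʳ x)

    δ-⁻¹ : ∀ a → δ (a ⁻¹) ≡ δ a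
    δ-⁻¹ a = 𝟙-cong (a ⁻¹ ≟ ε) (a ≟ ε) (mk⇔ (λ eq → trans (sym (⁻¹-involutive a)) (trans (cong _⁻¹ eq) ε⁻¹≈ε))
                              (λ eq → trans (cong _⁻¹ eq) ε⁻¹≈ε))

    corr-δˡ : ∀ v a → corr δ v a ≡ v (a ⁻¹)
    corr-δˡ v a = trans (sum-point ε (λ x → v (x ∙ a ⁻¹))) (cong v (identityˡ (a ⁻¹)))

    corr-δʳ : ∀ u a → corr u δ a ≡ u a
    corr-δʳ u a = trans (∑-cong elements swap-factors) (sum-point a u)
      where swap-factors : ∀ x → u x * δ (x ∙ a ⁻¹) ≡ 𝟙 (x ≟ a) * u x
            swap-factors x = trans (ℤ.*-comm (u x) _)
              (cong (_* u x) (𝟙-cong ((x ∙ a ⁻¹) ≟ ε) (x ≟ a) (mk⇔ (x∙y⁻¹≈ε⇒x≈y x a) x≈y⇒x∙y⁻¹≈ε)))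

    corr-1ˡ : ∀ v a → corr (λ _ → 1ℤ) v a ≡ sum v
    corr-1ˡ v a = trans (∑-cong elements (λ x → ℤ.*-identityˡ _)) (sum-translate a v)

    corr-1ʳ : ∀ u a → corr u (λ _ → 1ℤ) a ≡ sum u
    corr-1ʳ u a = ∑-cong elements (λ x → ℤ.*-identityʳ (u x))

    sum-corr : ∀ u v → sum (corr u v) ≡ sum u * sum v
    sum-corr u v = begin
      sum (λ a → sum (λ x → u x * v (x ∙ a ⁻¹))) ≡⟨ ∑-swap elements elements _ ⟩
      sum (λ x → sum (λ a → u x * v (x ∙ a ⁻¹))) ≡⟨ ∑-cong elements (λ x → ∑-*ˡ elements (u x) _) ⟩
      sum (λ x → u x * sum (λ a → v (x ∙ a ⁻¹))) ≡⟨ ∑-cong elements (λ x → cong (u x *_) (sum-reflect x v)) ⟩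
      sum (λ x → u x * sum v)                     ≡⟨ ∑-*ʳ elements (sum v) u ⟩
      sum u * sum v                               ∎
      where open ≡-Reasoning

    corr-affine : ∀ c d c′ d′ u v a →
                  corr (λ x → c * u x + d) (λ x → c′ * v x + d′) a
                  ≡ c * c′ * corr u v a + c * d′ * sum u + d * c′ * sum v + d * d′ * + size
    corr-affine c d c′ d′ u v a = begin
      sum (λ x → (c * u x + d) * (c′ * v (x ∙ a ⁻¹) + d′))
        ≡⟨ ∑-cong elements (λ x → expand c d c′ d′ (u x) (v (x ∙ a ⁻¹))) ⟩
      sum (λ x → c * c′ * (u x * v (x ∙ a ⁻¹)) + c * d′ * u x + d * c′ * v (x ∙ a ⁻¹) + d * d′ * 1ℤ)
        ≡⟨ trans (∑-+ elements _ _) (cong₂ _+_ (trans (∑-+ elements _ _) (cong₂ _+_ (∑-+ elements _ _) refl)) refl) ⟩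
      sum (λ x → c * c′ * (u x * v (x ∙ a ⁻¹))) + sum (λ x → c * d′ * u x)
        + sum (λ x → d * c′ * v (x ∙ a ⁻¹)) + sum (λ _ → d * d′ * 1ℤ)
        ≡⟨ cong₂ _+_ (cong₂ _+_ (cong₂ _+_ (∑-*ˡ elements (c * c′) (λ x → u x * v (x ∙ a ⁻¹)))
                                            (∑-*ˡ elements (c * d′) u))
                                (trans (∑-*ˡ elements (d * c′) (λ x → v (x ∙ a ⁻¹))) (cong (d * c′ *_) (sum-translate a v))))
                     (trans (∑-*ˡ elements (d * d′) (λ _ → 1ℤ)) (cong (d * d′ *_) sum-size)) ⟩
      c * c′ * corr u v a + c * d′ * sum u + d * c′ * sum v + d * d′ * + size ∎
      where
        open ≡-Reasoning
        expand : ∀ c d c′ d′ p q → (c * p + d) * (c′ * q + d′) ≡ c * c′ * (p * q) + c * d′ * p + d * c′ * q + d * d′ * 1ℤ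
        expand = solve-∀

    corr-sign : ∀ (e : A → ℤ) a →
                corr (λ x → + 2 * e x + -1ℤ) (λ x → + 2 * e x + -1ℤ) a ≡ + 4 * corr e e a - + 4 * sum e + + size
    corr-sign e a = trans (corr-affine (+ 2) -1ℤ (+ 2) -1ℤ e e a) (collect (corr e e a) (sum e) (+ size))
      where collect : ∀ c s n → + 2 * + 2 * c + + 2 * -1ℤ * s + -1ℤ * + 2 * s + -1ℤ * -1ℤ * n ≡ + 4 * c - + 4 * s + n
            collect = solve-∀

    corr-cong : ∀ {u u′ v v′} → (∀ x → u x ≡ u′ x) → (∀ x → v x ≡ v′ x) → ∀ a → corr u v a ≡ corr u′ v′ a
    corr-cong u≗u′ v≗v′ a = ∑-cong elements (λ x → cong₂ _*_ (u≗u′ x) (v≗v′ (x ∙ a ⁻¹)))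

    corr-+ˡ : ∀ u u′ v a → corr (λ x → u x + u′ x) v a ≡ corr u v a + corr u′ v a
    corr-+ˡ u u′ v a = trans (∑-cong elements (λ x → ℤ.*-distribʳ-+ (v (x ∙ a ⁻¹)) (u x) (u′ x))) (∑-+ elements _ _)

    corr-+ʳ : ∀ u v v′ a → corr u (λ x → v x + v′ x) a ≡ corr u v a + corr u v′ a
    corr-+ʳ u v v′ a = trans (∑-cong elements (λ x → ℤ.*-distribˡ-+ (u x) (v (x ∙ a ⁻¹)) (v′ (x ∙ a ⁻¹)))) (∑-+ elements _ _)

    corr-negˡ : ∀ u v a → corr (λ x → - u x) v a ≡ - corr u v a
    corr-negˡ u v a = trans (∑-cong elements (λ x → sym (ℤ.neg-distribˡ-* (u x) (v (x ∙ a ⁻¹))))) (∑-neg elements _)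

    corr-negʳ : ∀ u v a → corr u (λ x → - v x) a ≡ - corr u v a
    corr-negʳ u v a = trans (∑-cong elements (λ x → sym (ℤ.neg-distribʳ-* (u x) (v (x ∙ a ⁻¹))))) (∑-neg elements _)

    DifferencePairs : (A → Set) → A → A × A → Set
    DifferencePairs D g p = D (proj₁ p) × D (proj₂ p) × proj₁ p ≢ proj₂ p × proj₁ p ∙ proj₂ p ⁻¹ ≡ g

    module _ {D : A → Set} (D? : Decidable D) {g : A} (g≢ε : g ≢ ε) where
      private
        module Pairs = FiniteSum (finite ×ᶠ finite)

        DifferencePairs? : Decidable (DifferencePairs D g)
        DifferencePairs? (x , y) = D? x ×-dec D? y ×-dec ¬? (x ≟ y) ×-dec (x ∙ y ⁻¹ ≟ g)

        difference⇔ : ∀ {x y} → (x ≢ y × x ∙ y ⁻¹ ≡ g) ⇔ (y ≡ x ∙ g ⁻¹)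
        difference⇔ {x} {y} = mk⇔
          (λ (_ , x∙y⁻¹≡g) → trans (sym (x∙[x∙a⁻¹]⁻¹≡a x y)) (cong (λ z → x ∙ z ⁻¹) x∙y⁻¹≡g))
          (λ y≡x∙g⁻¹ → let x∙y⁻¹≡g = trans (cong (λ z → x ∙ z ⁻¹) y≡x∙g⁻¹) (x∙[x∙a⁻¹]⁻¹≡a x g) in
                       (λ x≡y → g≢ε (trans (sym x∙y⁻¹≡g) (x≈y⇒x∙y⁻¹≈ε x≡y))) , x∙y⁻¹≡g)

        pointwise : ∀ x y → 𝟙 (DifferencePairs? (x , y)) ≡ 𝟙 (y ≟ x ∙ g ⁻¹) * (𝟙 (D? x) * 𝟙 (D? y))
        pointwise x y = begin
          𝟙 (DifferencePairs? (x , y))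
            ≡⟨ 𝟙-× (D? x) _ ⟩
          𝟙 (D? x) * 𝟙 (D? y ×-dec ¬? (x ≟ y) ×-dec (x ∙ y ⁻¹ ≟ g))
            ≡⟨ cong (𝟙 (D? x) *_) (𝟙-× (D? y) _) ⟩
          𝟙 (D? x) * (𝟙 (D? y) * 𝟙 (¬? (x ≟ y) ×-dec (x ∙ y ⁻¹ ≟ g)))
            ≡⟨ cong (λ t → 𝟙 (D? x) * (𝟙 (D? y) * t)) (𝟙-cong (¬? (x ≟ y) ×-dec (x ∙ y ⁻¹ ≟ g)) (y ≟ x ∙ g ⁻¹) difference⇔) ⟩
          𝟙 (D? x) * (𝟙 (D? y) * 𝟙 (y ≟ x ∙ g ⁻¹))
            ≡⟨ rotate (𝟙 (D? x)) (𝟙 (D? y)) (𝟙 (y ≟ x ∙ g ⁻¹)) ⟩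
          𝟙 (y ≟ x ∙ g ⁻¹) * (𝟙 (D? x) * 𝟙 (D? y)) ∎
          where open ≡-Reasoning
                rotate : ∀ a b c → a * (b * c) ≡ c * (a * b)
                rotate = solve-∀

      count-differences : Pairs.sum (λ p → 𝟙 (DifferencePairs? p)) ≡ corr (λ x → 𝟙 (D? x)) (λ x → 𝟙 (D? x)) g
      count-differences = trans (∑-cartesianProduct elements elements _)
        (∑-cong elements (λ x → trans (∑-cong elements (pointwise x))
                                      (sum-point (x ∙ g ⁻¹) (λ y → 𝟙 (D? x) * 𝟙 (D? y)))))

      hasSize-differences⇔ : ∀ {k} → HasSize (DifferencePairs D g) k ⇔ corr (λ x → 𝟙 (D? x)) (λ x → 𝟙 (D? x)) g ≡ + k
      hasSize-differences⇔ = mk⇔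
        (λ hs → trans (sym count-differences) (Pairs.sum-𝟙 DifferencePairs? hs))
        (λ eq → Pairs.hasSize DifferencePairs? (trans count-differences eq))

  module Tensor (G H : FiniteAbelianGroup) where
    private
      module CG  = Correlation G
      module CH  = Correlation H
      module CGH = Correlation (G ×ᴳ H)
    open FiniteAbelianGroup G using () renaming (Carrier to A)
    open FiniteAbelianGroup H using () renaming (Carrier to B)

    infixr 7 _⊗_
    _⊗_ : (A → ℤ) → (B → ℤ) → A × B → ℤ
    (u ⊗ v) (x , y) = u x * v y

    sum-⊗ : ∀ u v → CGH.sum (u ⊗ v) ≡ CG.sum u * CH.sum v
    sum-⊗ u v = trans (∑-cartesianProduct CG.elements CH.elements _) (∑-⊗ CG.elements CH.elements u v)

    corr-⊗ : ∀ u u′ v v′ a b → CGH.corr (u ⊗ v) (u′ ⊗ v′) (a , b) ≡ CG.corr u u′ a * CH.corr v v′ b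
    corr-⊗ u u′ v v′ a b = trans (∑-cartesianProduct CG.elements CH.elements _)
      (trans (∑-cong CG.elements (λ x → ∑-cong CH.elements (λ y → interchange (u x) (v y) _ _)))
             (∑-⊗ CG.elements CH.elements _ _))
      where interchange : ∀ p q r s → p * q * (r * s) ≡ p * r * (q * s)
            interchange = solve-∀

module FiniteFields where

  open import Data.Integer using (_+_; _*_; -_; _-_)
  open FiniteSums
  open Correlations

  2*i≢1 : ∀ i → + 2 * i ≢ 1ℤ
  2*i≢1 (+ 0)             ()
  2*i≢1 (+ suc 0)         ()
  2*i≢1 (+ suc (suc n))   ()
  2*i≢1 -[1+ n ]          ()

  odd≢even : ∀ i j → + 2 * i + 1ℤ ≢ + 2 * j
  odd≢even i j eq = 2*i≢1 (j - i) (trans (distrib j i) (trans (cong (_- + 2 * i) (sym eq)) (cancel i)))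
    where distrib : ∀ j i → + 2 * (j - i) ≡ + 2 * j - + 2 * i
          distrib = solve-∀
          cancel : ∀ i → + 2 * i + 1ℤ - + 2 * i ≡ 1ℤ
          cancel = solve-∀

  finite : (F : FiniteField) → Finite (Carrier F)
  finite F = record
    { _≟_ = _≟_ ; elements = elements ; elements-unique = elements-unique ; elements-complete = elements-complete }
    where open FiniteField F

  additiveGroup : FiniteField → FiniteAbelianGroup
  additiveGroup F = record
    { Carrier = Carrier F ; _∙_ = F._+_ ; ε = F.0# ; _⁻¹ = F.-_
    ; isAbelianGroup = IsCommutativeRing.+-isAbelianGroup F.isCommutativeRing
    ; finite = finite F
    }
    where module F = FiniteField F

  module FieldArithmetic (K : FiniteField) where
    open FiniteField K renaming (Carrier to A; _≟_ to infix 4 _≟_; _+_ to infixl 6 _+ᴷ_; _*_ to infixl 7 _*ᴷ_; -_ to -ᴷ_; _-_ to infixl 6 _-ᴷ_)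
    open Correlation (additiveGroup K)
      using (sum; sum-size; sum-point; sum-involution; x∙y⁻¹≈ε⇒x≈y; inverseˡ-unique; identityʳ-unique)

    commutativeRing : CommutativeRing 0ℓ 0ℓ
    commutativeRing = record { isCommutativeRing = isCommutativeRing }

    open CommutativeRing commutativeRing public
      using (+-assoc; +-identityʳ; -‿inverseʳ; *-comm; *-assoc; *-identityˡ; zeroˡ; zeroʳ; ring; commutativeSemiring; *-commutativeSemigroup)
    open RingProperties ring public using (-‿distribˡ-*; -‿distribʳ-*)
    open CommutativeSemigroupProperties *-commutativeSemigroup public using () renaming (interchange to *-interchange)
    open import Algebra.Solver.Ring.NaturalCoefficients.Default commutativeSemiring public
      using (solve; _:=_; _:+_; _:*_; con)

    -- 0 ⁻¹ = 0 is a junk value that makes inversion an involution of the whole field.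
    infix 8 _⁻¹
    _⁻¹ : A → A
    x ⁻¹ with x ≟ 0#
    ... | yes _  = 0#
    ... | no x≢0 = proj₁ (inverse x x≢0)

    0⁻¹≡0 : 0# ⁻¹ ≡ 0#
    0⁻¹≡0 with 0# ≟ 0#
    ... | yes _   = refl
    ... | no 0≢0  = ⊥-elim (0≢0 refl)

    x*x⁻¹≡1 : ∀ {x} → x ≢ 0# → x *ᴷ x ⁻¹ ≡ 1#
    x*x⁻¹≡1 {x} x≢0 with x ≟ 0#
    ... | yes x≡0 = ⊥-elim (x≢0 x≡0)
    ... | no x≢0′ = proj₂ (inverse x x≢0′)

    *-cancelˡ : ∀ {c x y} → c ≢ 0# → c *ᴷ x ≡ c *ᴷ y → x ≡ y
    *-cancelˡ {c} {x} {y} c≢0 eq = begin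
      x                  ≡⟨ sym (*-identityˡ x) ⟩
      1# *ᴷ x            ≡⟨ cong (_*ᴷ x) (sym c⁻¹c≡1) ⟩
      c ⁻¹ *ᴷ c *ᴷ x     ≡⟨ *-assoc (c ⁻¹) c x ⟩
      c ⁻¹ *ᴷ (c *ᴷ x)   ≡⟨ cong (c ⁻¹ *ᴷ_) eq ⟩
      c ⁻¹ *ᴷ (c *ᴷ y)   ≡⟨ sym (*-assoc (c ⁻¹) c y) ⟩
      c ⁻¹ *ᴷ c *ᴷ y     ≡⟨ cong (_*ᴷ y) c⁻¹c≡1 ⟩
      1# *ᴷ y            ≡⟨ *-identityˡ y ⟩
      y                  ∎
      where open ≡-Reasoning
            c⁻¹c≡1 : c ⁻¹ *ᴷ c ≡ 1#
            c⁻¹c≡1 = trans (*-comm (c ⁻¹) c) (x*x⁻¹≡1 c≢0)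

    ⁻¹-unique : ∀ {x y} → x ≢ 0# → x *ᴷ y ≡ 1# → y ≡ x ⁻¹
    ⁻¹-unique x≢0 xy≡1 = *-cancelˡ x≢0 (trans xy≡1 (sym (x*x⁻¹≡1 x≢0)))

    x⁻¹≢0 : ∀ {x} → x ≢ 0# → x ⁻¹ ≢ 0#
    x⁻¹≢0 {x} x≢0 x⁻¹≡0 = 0≢1 (trans (sym (zeroʳ x)) (trans (cong (x *ᴷ_) (sym x⁻¹≡0)) (x*x⁻¹≡1 x≢0)))

    ⁻¹-involutive : ∀ x → x ⁻¹ ⁻¹ ≡ x
    ⁻¹-involutive x = by-cases (x ≟ 0#)
      where
        by-cases : Dec (x ≡ 0#) → x ⁻¹ ⁻¹ ≡ x
        by-cases (yes x≡0) = trans (cong (λ w → w ⁻¹ ⁻¹) x≡0) (trans (cong _⁻¹ 0⁻¹≡0) (trans 0⁻¹≡0 (sym x≡0)))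
        by-cases (no x≢0)  = sym (⁻¹-unique (x⁻¹≢0 x≢0) (trans (*-comm (x ⁻¹) x) (x*x⁻¹≡1 x≢0)))

    zero-product : ∀ {x y} → x *ᴷ y ≡ 0# → x ≡ 0# ⊎ y ≡ 0#
    zero-product {x} {y} xy≡0 with x ≟ 0#
    ... | yes x≡0 = inj₁ x≡0
    ... | no x≢0  = inj₂ (*-cancelˡ x≢0 (trans xy≡0 (sym (zeroʳ x))))

    square-roots : ∀ {z w} → z *ᴷ z ≡ w *ᴷ w → z ≡ w ⊎ z ≡ -ᴷ w
    square-roots {z} {w} zz≡ww with zero-product {z -ᴷ w} {z +ᴷ w} product≡0
      where
        product≡0 : (z -ᴷ w) *ᴷ (z +ᴷ w) ≡ 0#
        product≡0 = begin
          (z +ᴷ -ᴷ w) *ᴷ (z +ᴷ w)                 ≡⟨ expand z (-ᴷ w) w ⟩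
          z *ᴷ z +ᴷ -ᴷ w *ᴷ w +ᴷ z *ᴷ (w +ᴷ -ᴷ w)  ≡⟨ cong₂ (λ a b → a +ᴷ -ᴷ w *ᴷ w +ᴷ z *ᴷ b) zz≡ww (-‿inverseʳ w) ⟩
          w *ᴷ w +ᴷ -ᴷ w *ᴷ w +ᴷ z *ᴷ 0#           ≡⟨ cong₂ (λ a b → w *ᴷ w +ᴷ a +ᴷ b) (sym (-‿distribˡ-* w w)) (zeroʳ z) ⟩
          w *ᴷ w +ᴷ -ᴷ (w *ᴷ w) +ᴷ 0#              ≡⟨ trans (+-identityʳ _) (-‿inverseʳ (w *ᴷ w)) ⟩
          0#                                      ∎
          where open ≡-Reasoning
                expand : ∀ z v w → (z +ᴷ v) *ᴷ (z +ᴷ w) ≡ z *ᴷ z +ᴷ v *ᴷ w +ᴷ z *ᴷ (w +ᴷ v)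
                expand = solve 3 (λ z v w → (z :+ v) :* (z :+ w) := z :* z :+ v :* w :+ z :* (w :+ v)) refl
    ... | inj₁ z-w≡0 = inj₁ (x∙y⁻¹≈ε⇒x≈y z w z-w≡0)
    ... | inj₂ z+w≡0 = inj₂ (inverseˡ-unique z w z+w≡0)

    sum-linear : ∀ {c} d → c ≢ 0# → sum (λ w → 𝟙 (c *ᴷ w ≟ d)) ≡ 1ℤ
    sum-linear {c} d c≢0 = trans (∑-cong elements unique-solution) (sum-point w₀ (λ _ → 1ℤ))
      where
        w₀ : A
        w₀ = c ⁻¹ *ᴷ d
        cw₀≡d : c *ᴷ w₀ ≡ d
        cw₀≡d = trans (sym (*-assoc c (c ⁻¹) d)) (trans (cong (_*ᴷ d) (x*x⁻¹≡1 c≢0)) (*-identityˡ d))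
        unique-solution : ∀ w → 𝟙 (c *ᴷ w ≟ d) ≡ 𝟙 (w ≟ w₀) * 1ℤ
        unique-solution w = trans (𝟙-cong (c *ᴷ w ≟ d) (w ≟ w₀)
          (mk⇔ (λ cw≡d → *-cancelˡ c≢0 (trans cw≡d (sym cw₀≡d))) (λ w≡w₀ → trans (cong (c *ᴷ_) w≡w₀) cw₀≡d)))
          (sym (ℤ.*-identityʳ _))

    1+1≢0 : ∀ {s} → size ≡ 1 ℕ.+ 2 ℕ.* s → 1# +ᴷ 1# ≢ 0#
    1+1≢0 {s} size≡1+2s 1+1≡0 = odd≡even (sum-involution σ σ-involutive (λ _ → 1ℤ) (λ _ → refl))
      where
        open ≡-Reasoning
        σ : A → A
        σ x = x +ᴷ 1#
        σ-involutive : ∀ x → σ (σ x) ≡ x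
        σ-involutive x = trans (+-assoc x 1# 1#) (trans (cong (x +ᴷ_) 1+1≡0) (+-identityʳ x))
        no-fixed-point : ∀ x → 1ℤ * 𝟙 (σ x ≟ x) ≡ 0ℤ
        no-fixed-point x = cong (1ℤ *_) (𝟙-no (σ x ≟ x) (λ x+1≡x → 0≢1 (sym (identityʳ-unique x 1# x+1≡x))))
        odd≡even : (∃ λ s′ → sum (λ _ → 1ℤ) ≡ sum (λ x → 1ℤ * 𝟙 (σ x ≟ x)) + + 2 * s′) → ⊥
        odd≡even (s′ , parity) = odd≢even (+ s) s′ (begin
          + 2 * + s + 1ℤ                           ≡⟨ ℤ.+-comm (+ 2 * + s) 1ℤ ⟩
          1ℤ + + 2 * + s                           ≡⟨ cong (_+_ 1ℤ) (sym (ℤ.pos-* 2 s)) ⟩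
          + (1 ℕ.+ 2 ℕ.* s)                        ≡⟨ cong +_ (sym size≡1+2s) ⟩
          + size                                   ≡⟨ sym sum-size ⟩
          sum (λ _ → 1ℤ)                           ≡⟨ parity ⟩
          sum (λ x → 1ℤ * 𝟙 (σ x ≟ x)) + + 2 * s′  ≡⟨ cong (_+ + 2 * s′) (trans (∑-cong elements no-fixed-point) (∑-zero elements)) ⟩
          0ℤ + + 2 * s′                            ≡⟨ ℤ.+-identityˡ _ ⟩
          + 2 * s′                                 ∎)

  module QuadraticCharacter (K : FiniteField) {s : ℕ} (size≡1+2s : FiniteField.size K ≡ 1 ℕ.+ 2 ℕ.* s) where
    open FiniteField K renaming (Carrier to A; _≟_ to infix 4 _≟_; _+_ to infixl 6 _+ᴷ_; _*_ to infixl 7 _*ᴷ_; -_ to -ᴷ_; _-_ to infixl 6 _-ᴷ_)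
    open FieldArithmetic K
    open Correlation (additiveGroup K)
      using ( sum; sum-size; sum-point; sum-involution; sum-δ; x∙ε⁻¹≡x; sum-translate⁻; δ; corr; corr-cong; corr-affine
            ; ∙-cancelˡ; x≈z//y; //-rightDividesˡ; //-rightDividesʳ; inverseˡ-unique)
      renaming (⁻¹-involutive to -‿involutive; ε⁻¹≈ε to -0#≡0#)

    χ-zero : ∀ {y} → y ≡ 0# → χ y ≡ 0ℤ
    χ-zero {y} y≡0 with y ≟ 0#
    ... | yes _   = refl
    ... | no y≢0  = ⊥-elim (y≢0 y≡0)

    χ-square : ∀ {y} → y ≢ 0# → IsSquare y → χ y ≡ 1ℤ
    χ-square {y} y≢0 (r , rr≡y) with y ≟ 0#
    ... | yes y≡0 = ⊥-elim (y≢0 y≡0)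
    ... | no _ with any? (λ z → z *ᴷ z ≟ y) elements
    ...   | yes _      = refl
    ...   | no no-root = ⊥-elim (no-root (lose (elements-complete r) rr≡y))

    χ-nonsquare : ∀ {y} → ¬ IsSquare y → χ y ≡ -1ℤ
    χ-nonsquare {y} y-nonsquare with y ≟ 0#
    ... | yes y≡0 = ⊥-elim (y-nonsquare (0# , trans (zeroˡ 0#) (sym y≡0)))
    ... | no _ with any? (λ z → z *ᴷ z ≟ y) elements
    ...   | yes root = ⊥-elim (y-nonsquare (satisfied root))
    ...   | no _     = refl

    data χ-View (y : A) : Set where
      zero      : y ≡ 0# → χ-View y
      square    : y ≢ 0# → ∀ r → r *ᴷ r ≡ y → χ-View y
      nonsquare : ¬ IsSquare y → χ-View y

    χ-view : ∀ y → χ-View y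
    χ-view y with y ≟ 0#
    ... | yes y≡0 = zero y≡0
    ... | no y≢0 with any? (λ z → z *ᴷ z ≟ y) elements
    ...   | yes root   = square y≢0 (proj₁ (satisfied root)) (proj₂ (satisfied root))
    ...   | no no-root = nonsquare (λ (r , rr≡y) → no-root (lose (elements-complete r) rr≡y))

    private
      neg-square : ∀ r → -ᴷ r *ᴷ -ᴷ r ≡ r *ᴷ r
      neg-square r = trans (sym (-‿distribˡ-* r (-ᴷ r)))
        (trans (cong -ᴷ_ (sym (-‿distribʳ-* r r))) (-‿involutive (r *ᴷ r)))

      r≡-r⇒r≡0 : ∀ {r} → r ≡ -ᴷ r → r ≡ 0#
      r≡-r⇒r≡0 {r} r≡-r with zero-product {1# +ᴷ 1#} {r} (trans (double r) (trans (cong (r +ᴷ_) r≡-r) (-‿inverseʳ r)))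
        where double : ∀ r → (1# +ᴷ 1#) *ᴷ r ≡ r +ᴷ r
              double = solve 1 (λ r → con 2 :* r := r :+ r) refl
      ... | inj₁ 2≡0 = ⊥-elim (1+1≢0 {s} size≡1+2s 2≡0)
      ... | inj₂ r≡0 = r≡0

    roots : A → ℤ
    roots y = sum (λ z → 𝟙 (z *ᴷ z ≟ y))

    roots≡1+χ : ∀ y → roots y ≡ 1ℤ + χ y
    roots≡1+χ y with χ-view y
    ... | zero y≡0 = begin
      sum (λ z → 𝟙 (z *ᴷ z ≟ y))      ≡⟨ ∑-cong elements only-zero ⟩
      sum (λ z → 𝟙 (z ≟ 0#) * 1ℤ)     ≡⟨ sum-point 0# (λ _ → 1ℤ) ⟩
      1ℤ                              ≡⟨ cong (_+_ 1ℤ) (sym (χ-zero y≡0)) ⟩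
      1ℤ + χ y                        ∎
      where
        open ≡-Reasoning
        only-zero : ∀ z → 𝟙 (z *ᴷ z ≟ y) ≡ 𝟙 (z ≟ 0#) * 1ℤ
        only-zero z = trans (𝟙-cong (z *ᴷ z ≟ y) (z ≟ 0#)
          (mk⇔ (λ zz≡y → [ id , id ]′ (zero-product (trans zz≡y y≡0)))
               (λ z≡0 → trans (cong (λ w → w *ᴷ w) z≡0) (trans (zeroˡ 0#) (sym y≡0)))))
          (sym (ℤ.*-identityʳ _))
    ... | square y≢0 r rr≡y = begin
      sum (λ z → 𝟙 (z *ᴷ z ≟ y))                              ≡⟨ ∑-cong elements two-roots ⟩
      sum (λ z → 𝟙 (z ≟ r) * 1ℤ + 𝟙 (z ≟ -ᴷ r) * 1ℤ)          ≡⟨ ∑-+ elements _ _ ⟩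
      sum (λ z → 𝟙 (z ≟ r) * 1ℤ) + sum (λ z → 𝟙 (z ≟ -ᴷ r) * 1ℤ)
                                                              ≡⟨ cong₂ _+_ (sum-point r (λ _ → 1ℤ)) (sum-point (-ᴷ r) (λ _ → 1ℤ)) ⟩
      1ℤ + 1ℤ                                                 ≡⟨ cong (_+_ 1ℤ) (sym (χ-square y≢0 (r , rr≡y))) ⟩
      1ℤ + χ y                                                ∎
      where
        open ≡-Reasoning
        two-roots : ∀ z → 𝟙 (z *ᴷ z ≟ y) ≡ 𝟙 (z ≟ r) * 1ℤ + 𝟙 (z ≟ -ᴷ r) * 1ℤ
        two-roots z with z ≟ r | z ≟ -ᴷ r
        ... | yes z≡r | yes z≡-r = ⊥-elim (y≢0 (trans (sym rr≡y) (trans (cong (λ w → w *ᴷ w) r≡0) (zeroˡ 0#))))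
          where r≡0 : r ≡ 0#
                r≡0 = r≡-r⇒r≡0 (trans (sym z≡r) z≡-r)
        ... | yes refl | no _    = 𝟙-yes (z *ᴷ z ≟ y) rr≡y
        ... | no _    | yes refl = 𝟙-yes (-ᴷ r *ᴷ -ᴷ r ≟ y) (trans (neg-square r) rr≡y)
        ... | no z≢r  | no z≢-r  = 𝟙-no (z *ᴷ z ≟ y) (λ zz≡y → [ z≢r , z≢-r ]′ (square-roots (trans zz≡y (sym rr≡y))))
    ... | nonsquare y-nonsquare =
      trans (∑-cong elements (λ z → 𝟙-no (z *ᴷ z ≟ y) (λ zz≡y → y-nonsquare (z , zz≡y))))
            (trans (∑-zero elements) (cong (_+_ 1ℤ) (sym (χ-nonsquare y-nonsquare))))

    sum-roots : sum roots ≡ + size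
    sum-roots = begin
      sum (λ y → sum (λ z → 𝟙 (z *ᴷ z ≟ y))) ≡⟨ ∑-swap elements elements _ ⟩
      sum (λ z → sum (λ y → 𝟙 (z *ᴷ z ≟ y))) ≡⟨ ∑-cong elements (λ z → trans (∑-cong elements (flip-𝟙 z)) (sum-point (z *ᴷ z) (λ _ → 1ℤ))) ⟩
      sum (λ _ → 1ℤ)                          ≡⟨ sum-size ⟩
      + size                                  ∎
      where
        open ≡-Reasoning
        flip-𝟙 : ∀ z y → 𝟙 (z *ᴷ z ≟ y) ≡ 𝟙 (y ≟ z *ᴷ z) * 1ℤ
        flip-𝟙 z y = trans (𝟙-cong (z *ᴷ z ≟ y) (y ≟ z *ᴷ z) (mk⇔ sym sym)) (sym (ℤ.*-identityʳ _))

    χ≡roots-1 : ∀ y → χ y ≡ 1ℤ * roots y + -1ℤ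
    χ≡roots-1 y = trans (shift (χ y)) (cong (λ n → 1ℤ * n + -1ℤ) (sym (roots≡1+χ y)))
      where shift : ∀ c → c ≡ 1ℤ * (1ℤ + c) + -1ℤ
            shift = solve-∀

    sum-χ : sum χ ≡ 0ℤ
    sum-χ = begin
      sum χ                                   ≡⟨ ∑-cong elements χ≡roots-1 ⟩
      sum (λ y → 1ℤ * roots y + -1ℤ)          ≡⟨ ∑-+ elements _ _ ⟩
      sum (λ y → 1ℤ * roots y) + sum (λ _ → -1ℤ)
                                              ≡⟨ cong₂ _+_ (trans (∑-*ˡ elements 1ℤ roots) (trans (ℤ.*-identityˡ _) sum-roots))
                                                           (trans (∑-neg elements (λ _ → 1ℤ)) (cong -_ sum-size)) ⟩
      + size - + size                         ≡⟨ ℤ.+-inverseʳ (+ size) ⟩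
      0ℤ                                      ∎
      where open ≡-Reasoning

    module _ {b} (b≢0 : b ≢ 0#) where
      private
        roots-shifted : ∀ w → roots (w *ᴷ w +ᴷ b) ≡ sum (λ r → 𝟙 ((r +ᴷ r) *ᴷ w ≟ b -ᴷ r *ᴷ r))
        roots-shifted w = trans (sym (sum-translate⁻ w (λ z → 𝟙 (z *ᴷ z ≟ w *ᴷ w +ᴷ b))))
                                (∑-cong elements linearise)
          where
            expand : ∀ r w → (r +ᴷ w) *ᴷ (r +ᴷ w) ≡ w *ᴷ w +ᴷ ((r +ᴷ r) *ᴷ w +ᴷ r *ᴷ r)
            expand = solve 2 (λ r w → (r :+ w) :* (r :+ w) := w :* w :+ ((r :+ r) :* w :+ r :* r)) refl
            linearise : ∀ r → 𝟙 ((r +ᴷ w) *ᴷ (r +ᴷ w) ≟ w *ᴷ w +ᴷ b) ≡ 𝟙 ((r +ᴷ r) *ᴷ w ≟ b -ᴷ r *ᴷ r)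
            linearise r = 𝟙-cong ((r +ᴷ w) *ᴷ (r +ᴷ w) ≟ w *ᴷ w +ᴷ b) ((r +ᴷ r) *ᴷ w ≟ b -ᴷ r *ᴷ r) (mk⇔
              (λ eq → x≈z//y _ (r *ᴷ r) b (∙-cancelˡ (w *ᴷ w) _ b (trans (sym (expand r w)) eq)))
              (λ eq → trans (expand r w) (cong (w *ᴷ w +ᴷ_) (trans (cong (_+ᴷ r *ᴷ r) eq) (//-rightDividesˡ (r *ᴷ r) b)))))

        linear-solutions : ∀ r → sum (λ w → 𝟙 ((r +ᴷ r) *ᴷ w ≟ b -ᴷ r *ᴷ r)) ≡ 1ℤ - δ r
        linear-solutions r with r ≟ 0#
        ... | no r≢0   = sum-linear (b -ᴷ r *ᴷ r) (λ r+r≡0 → r≢0 (r≡-r⇒r≡0 (inverseˡ-unique r r r+r≡0)))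
        ... | yes refl = trans (∑-cong elements (λ w → 𝟙-no ((0# +ᴷ 0#) *ᴷ w ≟ b -ᴷ 0# *ᴷ 0#) (no-solution w)))
                               (∑-zero elements)
          where
            open ≡-Reasoning
            no-solution : ∀ w → (0# +ᴷ 0#) *ᴷ w ≢ b -ᴷ 0# *ᴷ 0#
            no-solution w eq = b≢0 (sym (begin
              0#                  ≡⟨ sym (zeroˡ w) ⟩
              0# *ᴷ w             ≡⟨ cong (_*ᴷ w) (sym (+-identityʳ 0#)) ⟩
              (0# +ᴷ 0#) *ᴷ w     ≡⟨ eq ⟩
              b +ᴷ -ᴷ (0# *ᴷ 0#)  ≡⟨ cong (λ t → b +ᴷ -ᴷ t) (zeroˡ 0#) ⟩
              b +ᴷ -ᴷ 0#          ≡⟨ cong (b +ᴷ_) -0#≡0# ⟩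
              b +ᴷ 0#             ≡⟨ +-identityʳ b ⟩
              b                   ∎))

        pair-with-root : ∀ w y → roots y * 𝟙 (w *ᴷ w ≟ y -ᴷ b) ≡ 𝟙 (y ≟ w *ᴷ w +ᴷ b) * roots y
        pair-with-root w y = trans (ℤ.*-comm (roots y) _) (cong (_* roots y) (𝟙-cong (w *ᴷ w ≟ y -ᴷ b) (y ≟ w *ᴷ w +ᴷ b)
          (mk⇔ (λ ww≡y-b → trans (sym (//-rightDividesˡ b y)) (cong (_+ᴷ b) (sym ww≡y-b)))
               (λ y≡ww+b → trans (sym (//-rightDividesʳ b (w *ᴷ w))) (cong (_-ᴷ b) (sym y≡ww+b))))))

      -- Writing z = r + w turns z² = w² + b into the linear equation (r + r) w = b − r² for w.
      corr-roots : corr roots roots b ≡ + size - 1ℤ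
      corr-roots = begin
        sum (λ y → roots y * sum (λ w → 𝟙 (w *ᴷ w ≟ y -ᴷ b)))
          ≡⟨ ∑-cong elements (λ y → sym (∑-*ˡ elements (roots y) (λ w → 𝟙 (w *ᴷ w ≟ y -ᴷ b)))) ⟩
        sum (λ y → sum (λ w → roots y * 𝟙 (w *ᴷ w ≟ y -ᴷ b)))
          ≡⟨ ∑-swap elements elements _ ⟩
        sum (λ w → sum (λ y → roots y * 𝟙 (w *ᴷ w ≟ y -ᴷ b)))
          ≡⟨ ∑-cong elements (λ w → trans (∑-cong elements (pair-with-root w)) (sum-point (w *ᴷ w +ᴷ b) roots)) ⟩
        sum (λ w → roots (w *ᴷ w +ᴷ b))
          ≡⟨ ∑-cong elements roots-shifted ⟩
        sum (λ w → sum (λ r → 𝟙 ((r +ᴷ r) *ᴷ w ≟ b -ᴷ r *ᴷ r)))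
          ≡⟨ trans (∑-swap elements elements _) (∑-cong elements linear-solutions) ⟩
        sum (λ r → 1ℤ - δ r)
          ≡⟨ trans (∑-- elements (λ _ → 1ℤ) δ) (cong₂ _-_ sum-size sum-δ) ⟩
        + size - 1ℤ ∎
        where open ≡-Reasoning

    private
      corr-χ-off-zero : ∀ {b} → b ≢ 0# → corr χ χ b ≡ -1ℤ
      corr-χ-off-zero {b} b≢0 = begin
        corr χ χ b
          ≡⟨ corr-cong χ≡roots-1 χ≡roots-1 b ⟩
        corr (λ y → 1ℤ * roots y + -1ℤ) (λ y → 1ℤ * roots y + -1ℤ) b
          ≡⟨ corr-affine 1ℤ -1ℤ 1ℤ -1ℤ roots roots b ⟩
        1ℤ * 1ℤ * corr roots roots b + 1ℤ * -1ℤ * sum roots + -1ℤ * 1ℤ * sum roots + -1ℤ * -1ℤ * + size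
          ≡⟨ cong₂ (λ c n → 1ℤ * 1ℤ * c + 1ℤ * -1ℤ * n + -1ℤ * 1ℤ * n + -1ℤ * -1ℤ * + size) (corr-roots b≢0) sum-roots ⟩
        1ℤ * 1ℤ * (+ size - 1ℤ) + 1ℤ * -1ℤ * + size + -1ℤ * 1ℤ * + size + -1ℤ * -1ℤ * + size
          ≡⟨ cancel (+ size) ⟩
        -1ℤ ∎
        where open ≡-Reasoning
              cancel : ∀ n → 1ℤ * 1ℤ * (n - 1ℤ) + 1ℤ * -1ℤ * n + -1ℤ * 1ℤ * n + -1ℤ * -1ℤ * n ≡ -1ℤ
              cancel = solve-∀

      χ≡1⇔ : ∀ {y} → χ y ≡ 1ℤ ⇔ (y ≢ 0# × IsSquare y)
      χ≡1⇔ {y} = mk⇔ to (λ (y≢0 , y-square) → χ-square y≢0 y-square)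
        where
          to : χ y ≡ 1ℤ → y ≢ 0# × IsSquare y
          to χy≡1 with χ-view y
          ... | zero y≡0          = case (trans (sym (χ-zero y≡0)) χy≡1) of λ ()
          ... | square y≢0 r rr≡y = y≢0 , r , rr≡y
          ... | nonsquare y-nonsq = case (trans (sym (χ-nonsquare y-nonsq)) χy≡1) of λ ()

    χ² : ∀ y → χ y * χ y ≡ 1ℤ - δ y
    χ² y with χ-view y
    ... | zero y≡0 rewrite χ-zero y≡0 | 𝟙-yes (y ≟ 0#) y≡0 = refl
    ... | square y≢0 r rr≡y rewrite χ-square y≢0 (r , rr≡y) | 𝟙-no (y ≟ 0#) y≢0 = refl
    ... | nonsquare y-nonsq rewrite χ-nonsquare y-nonsq | 𝟙-no (y ≟ 0#) (λ y≡0 → y-nonsq (0# , trans (zeroˡ 0#) (sym y≡0))) = refl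

    corr-χ : ∀ b → corr χ χ b ≡ + size * δ b - 1ℤ
    corr-χ b with b ≟ 0#
    ... | yes refl = begin
      sum (λ y → χ y * χ (y -ᴷ 0#)) ≡⟨ ∑-cong elements (λ y → trans (cong (λ z → χ y * χ z) (x∙ε⁻¹≡x y)) (χ² y)) ⟩
      sum (λ y → 1ℤ - δ y)          ≡⟨ trans (∑-- elements (λ _ → 1ℤ) δ) (cong₂ _-_ sum-size sum-δ) ⟩
      + size - 1ℤ                   ≡⟨ cong (_- 1ℤ) (sym (ℤ.*-identityʳ (+ size))) ⟩
      + size * 1ℤ - 1ℤ              ∎
      where open ≡-Reasoning
    ... | no b≢0 = trans (corr-χ-off-zero b≢0) (cong (_- 1ℤ) (sym (ℤ.*-zeroʳ (+ size))))

    private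
      nonzero-square : A → ℤ
      nonzero-square x = 𝟙 (χ x ℤ.≟ 1ℤ)

      square-count : sum nonzero-square * + 2 ≡ + size - 1ℤ
      square-count = begin
        sum nonzero-square * + 2             ≡⟨ sym (∑-*ʳ elements (+ 2) nonzero-square) ⟩
        sum (λ x → nonzero-square x * + 2)   ≡⟨ ∑-cong elements twice-indicator ⟩
        sum (λ x → χ x + (1ℤ - δ x))          ≡⟨ trans (∑-+ elements χ _) (cong₂ _+_ sum-χ (∑-- elements (λ _ → 1ℤ) δ)) ⟩
        0ℤ + (sum (λ _ → 1ℤ) - sum δ)         ≡⟨ trans (ℤ.+-identityˡ _) (cong₂ _-_ sum-size sum-δ) ⟩
        + size - 1ℤ                           ∎
        where
          open ≡-Reasoning
          twice-indicator : ∀ x → nonzero-square x * + 2 ≡ χ x + (1ℤ - δ x)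
          twice-indicator x with χ-view x
          ... | zero x≡0 rewrite χ-zero x≡0 | 𝟙-yes (x ≟ 0#) x≡0 = refl
          ... | square x≢0 r rr≡x rewrite χ-square x≢0 (r , rr≡x) | 𝟙-no (x ≟ 0#) x≢0 = refl
          ... | nonsquare x-nonsq rewrite χ-nonsquare x-nonsq | 𝟙-no (x ≟ 0#) (λ x≡0 → x-nonsq (0# , trans (zeroˡ 0#) (sym x≡0))) = refl

      1≢0 : 1# ≢ 0#
      1≢0 1≡0 = 0≢1 (sym 1≡0)

      1≢-1 : 1# ≢ -ᴷ 1#
      1≢-1 1≡-1 = 1≢0 (r≡-r⇒r≡0 1≡-1)

      1⁻¹≡1 : 1# ⁻¹ ≡ 1#
      1⁻¹≡1 = sym (⁻¹-unique 1≢0 (*-identityˡ 1#))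

      -1≢0 : -ᴷ 1# ≢ 0#
      -1≢0 -1≡0 = 1≢0 (trans (sym (-‿involutive 1#)) (trans (cong -ᴷ_ -1≡0) -0#≡0#))

      -1⁻¹≡-1 : (-ᴷ 1#) ⁻¹ ≡ -ᴷ 1#
      -1⁻¹≡-1 = sym (⁻¹-unique -1≢0 (trans (neg-square 1#) (*-identityˡ 1#)))

      square-⁻¹ : ∀ {x} → x ≢ 0# → IsSquare x → IsSquare (x ⁻¹)
      square-⁻¹ {x} x≢0 (r , rr≡x) = r ⁻¹ , ⁻¹-unique x≢0 (begin
        x *ᴷ (r ⁻¹ *ᴷ r ⁻¹)          ≡⟨ cong (_*ᴷ (r ⁻¹ *ᴷ r ⁻¹)) (sym rr≡x) ⟩
        r *ᴷ r *ᴷ (r ⁻¹ *ᴷ r ⁻¹)     ≡⟨ *-interchange r r (r ⁻¹) (r ⁻¹) ⟩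
        r *ᴷ r ⁻¹ *ᴷ (r *ᴷ r ⁻¹)     ≡⟨ cong₂ _*ᴷ_ (x*x⁻¹≡1 r≢0) (x*x⁻¹≡1 r≢0) ⟩
        1# *ᴷ 1#                     ≡⟨ *-identityˡ 1# ⟩
        1#                           ∎)
        where
          open ≡-Reasoning
          r≢0 : r ≢ 0#
          r≢0 r≡0 = x≢0 (trans (sym rr≡x) (trans (cong (λ w → w *ᴷ w) r≡0) (zeroˡ 0#)))

      χ≡1⇒χ⁻¹≡1 : ∀ {x} → χ x ≡ 1ℤ → χ (x ⁻¹) ≡ 1ℤ
      χ≡1⇒χ⁻¹≡1 χx≡1 = let (x≢0 , x-square) = Equivalence.to χ≡1⇔ χx≡1 in χ-square (x⁻¹≢0 x≢0) (square-⁻¹ x≢0 x-square)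

      nonzero-square-⁻¹ : ∀ x → nonzero-square (x ⁻¹) ≡ nonzero-square x
      nonzero-square-⁻¹ x = 𝟙-cong (χ (x ⁻¹) ℤ.≟ 1ℤ) (χ x ℤ.≟ 1ℤ)
        (mk⇔ (λ χx⁻¹≡1 → subst (λ y → χ y ≡ 1ℤ) (⁻¹-involutive x) (χ≡1⇒χ⁻¹≡1 χx⁻¹≡1)) χ≡1⇒χ⁻¹≡1)

      fixed-points : ∀ x → nonzero-square x * 𝟙 (x ⁻¹ ≟ x) ≡ 𝟙 (x ≟ 1#) * 1ℤ + 𝟙 (x ≟ -ᴷ 1#) * nonzero-square (-ᴷ 1#)
      fixed-points x with x ≟ 1# | x ≟ -ᴷ 1#
      ... | yes refl | yes 1≡-1 = ⊥-elim (1≢-1 1≡-1)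
      ... | yes refl | no _
        rewrite 𝟙-yes (χ 1# ℤ.≟ 1ℤ) (χ-square 1≢0 (1# , *-identityˡ 1#)) | 𝟙-yes (1# ⁻¹ ≟ 1#) 1⁻¹≡1 = refl
      ... | no _     | yes refl
        rewrite 𝟙-yes ((-ᴷ 1#) ⁻¹ ≟ -ᴷ 1#) -1⁻¹≡-1 = rearrange (nonzero-square (-ᴷ 1#))
        where rearrange : ∀ p → p * 1ℤ ≡ 0ℤ * 1ℤ + 1ℤ * p
              rearrange = solve-∀
      ... | no x≢1   | no x≢-1 with χ x ℤ.≟ 1ℤ | x ⁻¹ ≟ x
      ...   | yes χx≡1 | yes x⁻¹≡x = ⊥-elim ([ x≢1 , x≢-1 ]′ (square-roots (begin
              x *ᴷ x       ≡⟨ cong (x *ᴷ_) (sym x⁻¹≡x) ⟩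
              x *ᴷ x ⁻¹    ≡⟨ x*x⁻¹≡1 (proj₁ (Equivalence.to χ≡1⇔ χx≡1)) ⟩
              1#           ≡⟨ sym (*-identityˡ 1#) ⟩
              1# *ᴷ 1#     ∎)))
        where open ≡-Reasoning
      ...   | yes _ | no _  = refl
      ...   | no _  | yes _ = refl
      ...   | no _  | no _  = refl

    private
      nonzero-squares-parity : ∃ λ s → sum nonzero-square ≡ 1ℤ + nonzero-square (-ᴷ 1#) + + 2 * s
      nonzero-squares-parity = count-fixed-points (sum-involution _⁻¹ ⁻¹-involutive nonzero-square nonzero-square-⁻¹)
        where
          open ≡-Reasoning
          count-fixed-points : (∃ λ s → sum nonzero-square ≡ sum (λ x → nonzero-square x * 𝟙 (x ⁻¹ ≟ x)) + + 2 * s) →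
                               ∃ λ s → sum nonzero-square ≡ 1ℤ + nonzero-square (-ᴷ 1#) + + 2 * s
          count-fixed-points (s′ , parity) = s′ , (begin
            sum nonzero-square
              ≡⟨ parity ⟩
            sum (λ x → nonzero-square x * 𝟙 (x ⁻¹ ≟ x)) + + 2 * s′
              ≡⟨ cong (_+ + 2 * s′) (trans (∑-cong elements fixed-points) (∑-+ elements _ _)) ⟩
            sum (λ x → 𝟙 (x ≟ 1#) * 1ℤ) + sum (λ x → 𝟙 (x ≟ -ᴷ 1#) * nonzero-square (-ᴷ 1#)) + + 2 * s′
              ≡⟨ cong (_+ + 2 * s′) (cong₂ _+_ (sum-point 1# (λ _ → 1ℤ)) (sum-point (-ᴷ 1#) (λ _ → nonzero-square (-ᴷ 1#)))) ⟩
            1ℤ + nonzero-square (-ᴷ 1#) + + 2 * s′ ∎)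

    -- Inversion pairs up the nonzero squares, fixing only 1 and possibly -1; as there is an even number
    -- (|K| - 1) / 2 of them, -1 must be one of them.
    -1-isSquare : ∀ {t} → size ≡ 1 ℕ.+ 4 ℕ.* t → IsSquare (-ᴷ 1#)
    -1-isSquare {t} size≡1+4t with χ-view (-ᴷ 1#)
    ... | zero -1≡0          = ⊥-elim (-1≢0 -1≡0)
    ... | square _ r rr≡-1   = r , rr≡-1
    ... | nonsquare -1-nonsq = ⊥-elim (even≡odd nonzero-squares-parity)
      where
        open ≡-Reasoning
        -1-uncounted : nonzero-square (-ᴷ 1#) ≡ 0ℤ
        -1-uncounted = 𝟙-no (χ (-ᴷ 1#) ℤ.≟ 1ℤ) (λ χ≡1 → -1-nonsq (proj₂ (Equivalence.to χ≡1⇔ χ≡1)))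
        rearrange : ∀ s → + 2 * (+ 2 * s + 1ℤ) ≡ (1ℤ + 0ℤ + + 2 * s) * + 2
        rearrange = solve-∀
        collect : ∀ t → 1ℤ + + 4 * t - 1ℤ ≡ + 2 * (+ 2 * t)
        collect = solve-∀
        even≡odd : (∃ λ s → sum nonzero-square ≡ 1ℤ + nonzero-square (-ᴷ 1#) + + 2 * s) → ⊥
        even≡odd (s′ , parity) = odd≢even s′ (+ t) (ℤ.*-cancelˡ-≡ (+ 2) _ _ (begin
          + 2 * (+ 2 * s′ + 1ℤ)                           ≡⟨ rearrange s′ ⟩
          (1ℤ + 0ℤ + + 2 * s′) * + 2                      ≡⟨ cong (λ n → (1ℤ + n + + 2 * s′) * + 2) (sym -1-uncounted) ⟩
          (1ℤ + nonzero-square (-ᴷ 1#) + + 2 * s′) * + 2  ≡⟨ cong (_* + 2) (sym parity) ⟩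
          sum nonzero-square * + 2                        ≡⟨ square-count ⟩
          + size - 1ℤ                                     ≡⟨ cong (λ n → + n - 1ℤ) size≡1+4t ⟩
          + (1 ℕ.+ 4 ℕ.* t) - 1ℤ                          ≡⟨ cong (_- 1ℤ) (trans (ℤ.pos-+ 1 (4 ℕ.* t)) (cong (_+_ 1ℤ) (ℤ.pos-* 4 t))) ⟩
          1ℤ + + 4 * + t - 1ℤ                             ≡⟨ collect (+ t) ⟩
          + 2 * (+ 2 * + t)                               ∎))

    module _ {t} (size≡1+4t : size ≡ 1 ℕ.+ 4 ℕ.* t) where
      private
        i : A
        i = proj₁ (-1-isSquare {t} size≡1+4t)
        times-i : ∀ r → (i *ᴷ r) *ᴷ (i *ᴷ r) ≡ -ᴷ (r *ᴷ r)
        times-i r = begin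
          i *ᴷ r *ᴷ (i *ᴷ r)      ≡⟨ *-interchange i r i r ⟩
          i *ᴷ i *ᴷ (r *ᴷ r)      ≡⟨ cong (_*ᴷ (r *ᴷ r)) (proj₂ (-1-isSquare {t} size≡1+4t)) ⟩
          -ᴷ 1# *ᴷ (r *ᴷ r)       ≡⟨ sym (-‿distribˡ-* 1# (r *ᴷ r)) ⟩
          -ᴷ (1# *ᴷ (r *ᴷ r))     ≡⟨ cong -ᴷ_ (*-identityˡ (r *ᴷ r)) ⟩
          -ᴷ (r *ᴷ r)             ∎
          where open ≡-Reasoning

      χ-neg : ∀ y → χ (-ᴷ y) ≡ χ y
      χ-neg y with χ-view y
      ... | zero y≡0          = trans (χ-zero (trans (cong -ᴷ_ y≡0) -0#≡0#)) (sym (χ-zero y≡0))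
      ... | square y≢0 r rr≡y = trans (χ-square -y≢0 (i *ᴷ r , trans (times-i r) (cong -ᴷ_ rr≡y)))
                                      (sym (χ-square y≢0 (r , rr≡y)))
        where -y≢0 : -ᴷ y ≢ 0#
              -y≢0 -y≡0 = y≢0 (trans (sym (-‿involutive y)) (trans (cong -ᴷ_ -y≡0) -0#≡0#))
      ... | nonsquare y-nonsq = trans (χ-nonsquare -y-nonsquare) (sym (χ-nonsquare y-nonsq))
        where -y-nonsquare : ¬ IsSquare (-ᴷ y)
              -y-nonsquare (w , ww≡-y) = y-nonsq (i *ᴷ w , trans (times-i w) (trans (cong -ᴷ_ ww≡-y) (-‿involutive y)))

module SkewHadamardSets where

  open import Data.Integer using (_+_; _*_; -_; _-_)
  open FiniteSums
  open Correlations
  open FiniteFields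

  module SkewHadamard (F : FiniteField) {E : Carrier F → Set} (skew : IsSkewHadamard F E) where
    open Correlation (additiveGroup F)

    k λ′ : ℕ
    k  = proj₁ (proj₁ skew)
    λ′ = proj₁ (proj₂ (proj₁ skew))

    private
      E-size : HasSize E k
      E-size = proj₁ (proj₂ (proj₂ (proj₂ (proj₁ skew))))
      E-differences : ∀ g → g ≢ ε → HasSize (DifferencePairs E g) λ′
      E-differences = proj₂ (proj₂ (proj₂ (proj₂ (proj₁ skew))))
      E⊎-E⊎0 : ∀ x → E x ⊎ NegSet F E x ⊎ x ≡ ε
      E⊎-E⊎0 = proj₁ (proj₂ skew)
      E∩-E : ∀ x → ¬ (E x × NegSet F E x)
      E∩-E = proj₁ (proj₂ (proj₂ skew))
      E∌0 : ∀ x → ¬ (E x × x ≡ ε)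
      E∌0 = proj₁ (proj₂ (proj₂ (proj₂ skew)))

    E? : Decidable E
    E? x = map′ (Equivalence.to (proj₁ (proj₂ (proj₂ E-size)) x)) (Equivalence.from (proj₁ (proj₂ (proj₂ E-size)) x))
                (_∈?_ _≟_ x (proj₁ E-size))

    e : A → ℤ
    e x = 𝟙 (E? x)

    NegSet⇔ : ∀ {x} → NegSet F E x ⇔ E (x ⁻¹)
    NegSet⇔ {x} = mk⇔ (λ (y , Ey , x≡-y) → subst E (sym (trans (cong _⁻¹ x≡-y) (⁻¹-involutive y))) Ey)
                      (λ E-x → x ⁻¹ , E-x , sym (⁻¹-involutive x))

    NegSet? : Decidable (NegSet F E)
    NegSet? x = map′ (Equivalence.from NegSet⇔) (Equivalence.to NegSet⇔) (E? (x ⁻¹))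

    partition : ∀ x → e x + e (x ⁻¹) + δ x ≡ 1ℤ
    partition x with E⊎-E⊎0 x
    ... | inj₁ Ex
        rewrite 𝟙-yes (E? x) Ex | 𝟙-no (E? (x ⁻¹)) (λ E-x → E∩-E x (Ex , Equivalence.from NegSet⇔ E-x))
              | 𝟙-no (x ≟ ε) (λ x≡ε → E∌0 x (Ex , x≡ε)) = refl
    ... | inj₂ (inj₁ -Ex)
        rewrite 𝟙-no (E? x) (λ Ex → E∩-E x (Ex , -Ex)) | 𝟙-yes (E? (x ⁻¹)) (Equivalence.to NegSet⇔ -Ex)
              | 𝟙-no (x ≟ ε) (λ x≡ε → E∌0 (x ⁻¹) (Equivalence.to NegSet⇔ -Ex , trans (cong _⁻¹ x≡ε) ε⁻¹≈ε)) = refl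
    ... | inj₂ (inj₂ x≡ε)
        rewrite 𝟙-no (E? x) (λ Ex → E∌0 x (Ex , x≡ε)) | 𝟙-no (E? (x ⁻¹)) (λ E-x → E∌0 (x ⁻¹) (E-x , trans (cong _⁻¹ x≡ε) ε⁻¹≈ε))
              | 𝟙-yes (x ≟ ε) x≡ε = refl

    sum-e : sum e ≡ + k
    sum-e = sum-𝟙 E? E-size

    size≡2k+1 : + size ≡ + 2 * + k + 1ℤ
    size≡2k+1 = begin
      + size                               ≡⟨ sym sum-size ⟩
      sum (λ _ → 1ℤ)                       ≡⟨ sym (∑-cong elements partition) ⟩
      sum (λ x → e x + e (x ⁻¹) + δ x)     ≡⟨ trans (∑-+ elements _ δ) (cong₂ _+_ (∑-+ elements e (λ x → e (x ⁻¹))) sum-δ) ⟩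
      sum e + sum (λ x → e (x ⁻¹)) + 1ℤ    ≡⟨ cong₂ (λ m n → m + n + 1ℤ) sum-e (trans (sum-inverse e) sum-e) ⟩
      + k + + k + 1ℤ                       ≡⟨ double (+ k) ⟩
      + 2 * + k + 1ℤ                       ∎
      where open ≡-Reasoning
            double : ∀ k → k + k + 1ℤ ≡ + 2 * k + 1ℤ
            double = solve-∀

    corr-e : ∀ a → corr e e a ≡ δ a * + k + (1ℤ - δ a) * + λ′
    corr-e a with a ≟ ε
    ... | yes refl = trans (∑-cong elements idempotent) (trans sum-e (only-k (+ k) (+ λ′)))
      where idempotent : ∀ x → e x * e (x ∙ ε ⁻¹) ≡ e x
            idempotent x rewrite x∙ε⁻¹≡x x with E? x
            ... | yes _ = refl
            ... | no _  = refl
            only-k : ∀ k l → k ≡ 1ℤ * k + (1ℤ - 1ℤ) * l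
            only-k = solve-∀
    ... | no a≢ε = trans (Equivalence.to (hasSize-differences⇔ E? a≢ε) (E-differences a a≢ε)) (only-λ (+ k) (+ λ′))
      where only-λ : ∀ k l → l ≡ 0ℤ * k + (1ℤ - 0ℤ) * l
            only-λ = solve-∀

    private
      k≡suc : ∃ λ k′ → k ≡ suc k′
      k≡suc with E-size | E⊎-E⊎0 (FiniteField.1# F)
      ... | _ , _ , _ , _              | inj₂ (inj₂ 1≡0) = ⊥-elim (FiniteField.0≢1 F (sym 1≡0))
      ... | (_ ∷ xs) , _ , _ , |xs|≡k | _               = length xs , sym |xs|≡k
      ... | [] , _ , ∈[]⇔E , _          | inj₁ E1         = case Equivalence.from (∈[]⇔E _) E1 of λ ()
      ... | [] , _ , ∈[]⇔E , _          | inj₂ (inj₁ (y , Ey , _)) = case Equivalence.from (∈[]⇔E y) Ey of λ ()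

    k≡1+2λ : + k ≡ 1ℤ + + 2 * + λ′
    k≡1+2λ = ℤ.*-cancelˡ-≡ (+ k) (+ k) (1ℤ + + 2 * + λ′) {{k-nonzero}} (begin
      + k * + k                                         ≡⟨ cong₂ _*_ (sym sum-e) (sym sum-e) ⟩
      sum e * sum e                                     ≡⟨ sym (sum-corr e e) ⟩
      sum (corr e e)                                    ≡⟨ ∑-cong elements corr-e ⟩
      sum (λ a → δ a * + k + (1ℤ - δ a) * + λ′)         ≡⟨ ∑-+ elements _ _ ⟩
      sum (λ a → δ a * + k) + sum (λ a → (1ℤ - δ a) * + λ′)
                                                        ≡⟨ cong₂ _+_ (∑-*ʳ elements (+ k) δ) (∑-*ʳ elements (+ λ′) (λ a → 1ℤ - δ a)) ⟩
      sum δ * + k + sum (λ a → 1ℤ - δ a) * + λ′         ≡⟨ cong₂ (λ m n → m * + k + n * + λ′) sum-δ (trans (∑-- elements _ δ) (cong₂ _-_ sum-size sum-δ)) ⟩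
      1ℤ * + k + (+ size - 1ℤ) * + λ′                   ≡⟨ cong (λ n → 1ℤ * + k + (n - 1ℤ) * + λ′) size≡2k+1 ⟩
      1ℤ * + k + (+ 2 * + k + 1ℤ - 1ℤ) * + λ′           ≡⟨ factor (+ k) (+ λ′) ⟩
      + k * (1ℤ + + 2 * + λ′)                           ∎)
      where
        open ≡-Reasoning
        k-nonzero : NonZero (+ k)
        k-nonzero rewrite proj₂ k≡suc = _
        factor : ∀ k l → 1ℤ * k + (+ 2 * k + 1ℤ - 1ℤ) * l ≡ k * (1ℤ + + 2 * l)
        factor = solve-∀

    ψ : A → ℤ
    ψ x = e x - e (x ⁻¹)

    sign-E : A → ℤ
    sign-E x = + 2 * e x + -1ℤ

    ψ≡sign-E+δ : ∀ x → ψ x ≡ sign-E x + δ x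
    ψ≡sign-E+δ x = trans (rearrange (e x) (e (x ⁻¹)) (δ x))
      (trans (cong (λ n → sign-E x + δ x + (1ℤ - n)) (partition x)) (ℤ.+-identityʳ _))
      where rearrange : ∀ a b c → a - b ≡ + 2 * a + -1ℤ + c + (1ℤ - (a + b + c))
            rearrange = solve-∀

    ψ-⁻¹ : ∀ x → ψ (x ⁻¹) ≡ - ψ x
    ψ-⁻¹ x = trans (cong (λ y → e (x ⁻¹) - e y) (⁻¹-involutive x)) (flip-sign (e (x ⁻¹)) (e x))
      where flip-sign : ∀ a b → a - b ≡ - (b - a)
            flip-sign = solve-∀

    sum-ψ : sum ψ ≡ 0ℤ
    sum-ψ = trans (∑-- elements e (λ x → e (x ⁻¹)))
                  (trans (cong₂ _-_ sum-e (trans (sum-inverse e) sum-e)) (ℤ.+-inverseʳ (+ k)))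

    corr-ψ : ∀ a → corr ψ ψ a ≡ + size * δ a - 1ℤ
    corr-ψ a = begin
      corr ψ ψ a
        ≡⟨ corr-cong ψ≡sign-E+δ ψ≡sign-E+δ a ⟩
      corr (λ x → sign-E x + δ x) (λ x → sign-E x + δ x) a
        ≡⟨ trans (corr-+ˡ sign-E δ (λ x → sign-E x + δ x) a) (cong₂ _+_ (corr-+ʳ sign-E sign-E δ a) (corr-+ʳ δ sign-E δ a)) ⟩
      corr sign-E sign-E a + corr sign-E δ a + (corr δ sign-E a + corr δ δ a)
        ≡⟨ cong₂ _+_ (cong₂ _+_ (corr-sign e a) (corr-δʳ sign-E a)) (cong₂ _+_ (corr-δˡ sign-E a) (trans (corr-δˡ δ a) (δ-⁻¹ a))) ⟩
      + 4 * corr e e a - + 4 * sum e + + size + sign-E a + (sign-E (a ⁻¹) + δ a)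
        ≡⟨ cong₂ (λ c s → + 4 * c - + 4 * s + + size + sign-E a + (sign-E (a ⁻¹) + δ a)) (corr-e a) sum-e ⟩
      + 4 * (δ a * + k + (1ℤ - δ a) * + λ′) - + 4 * + k + + size + sign-E a + (sign-E (a ⁻¹) + δ a)
        ≡⟨ arithmetic (δ a) (e a) (e (a ⁻¹)) (+ k) (+ λ′) (+ size) (partition a) k≡1+2λ size≡2k+1 ⟩
      + size * δ a - 1ℤ ∎
      where
        open ≡-Reasoning
        identity : ∀ d ea eb l →
          + 4 * (d * (1ℤ + + 2 * l) + (1ℤ - d) * l) - + 4 * (1ℤ + + 2 * l) + (+ 2 * (1ℤ + + 2 * l) + 1ℤ)
            + (+ 2 * ea + -1ℤ) + (+ 2 * eb + -1ℤ + d)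
          ≡ (+ 2 * (1ℤ + + 2 * l) + 1ℤ) * d - 1ℤ + + 2 * (ea + eb + d - 1ℤ)
        identity = solve-∀
        arithmetic : ∀ d ea eb k l s → ea + eb + d ≡ 1ℤ → k ≡ 1ℤ + + 2 * l → s ≡ + 2 * k + 1ℤ →
          + 4 * (d * k + (1ℤ - d) * l) - + 4 * k + s + (+ 2 * ea + -1ℤ) + (+ 2 * eb + -1ℤ + d) ≡ s * d - 1ℤ
        arithmetic d ea eb _ l _ partition refl refl = trans (identity d ea eb l)
          (trans (cong (λ n → (+ 2 * (1ℤ + + 2 * l) + 1ℤ) * d - 1ℤ + + 2 * (n - 1ℤ)) partition) (ℤ.+-identityʳ _))

    data ψ-View (x : A) : Set where
      in-E  : E x → ¬ NegSet F E x → ψ x ≡ 1ℤ → δ x ≡ 0ℤ → ψ-View x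
      in-−E : ¬ E x → NegSet F E x → ψ x ≡ -1ℤ → δ x ≡ 0ℤ → ψ-View x
      zero  : ¬ E x → ¬ NegSet F E x → ψ x ≡ 0ℤ → δ x ≡ 1ℤ → ψ-View x

    ψ-view : ∀ x → ψ-View x
    ψ-view x with E⊎-E⊎0 x
    ... | inj₁ Ex = in-E Ex (λ -Ex → E∩-E x (Ex , -Ex))
      (cong₂ _-_ (𝟙-yes (E? x) Ex) (𝟙-no (E? (x ⁻¹)) (λ E-x → E∩-E x (Ex , Equivalence.from NegSet⇔ E-x))))
      (𝟙-no (x ≟ ε) (λ x≡ε → E∌0 x (Ex , x≡ε)))
    ... | inj₂ (inj₁ -Ex) = in-−E (λ Ex → E∩-E x (Ex , -Ex)) -Ex
      (cong₂ _-_ (𝟙-no (E? x) (λ Ex → E∩-E x (Ex , -Ex))) (𝟙-yes (E? (x ⁻¹)) (Equivalence.to NegSet⇔ -Ex)))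
      (𝟙-no (x ≟ ε) (λ x≡ε → E∌0 (x ⁻¹) (Equivalence.to NegSet⇔ -Ex , trans (cong _⁻¹ x≡ε) ε⁻¹≈ε)))
    ... | inj₂ (inj₂ x≡ε) = zero ¬Ex ¬-Ex
      (cong₂ _-_ (𝟙-no (E? x) ¬Ex) (𝟙-no (E? (x ⁻¹)) (λ E-x → ¬-Ex (Equivalence.from NegSet⇔ E-x))))
      (𝟙-yes (x ≟ ε) x≡ε)
      where ¬Ex : ¬ E x
            ¬Ex Ex = E∌0 x (Ex , x≡ε)
            ¬-Ex : ¬ NegSet F E x
            ¬-Ex -Ex = E∌0 (x ⁻¹) (Equivalence.to NegSet⇔ -Ex , trans (cong _⁻¹ x≡ε) ε⁻¹≈ε)

    size≡3+4λ : size ≡ 3 ℕ.+ 4 ℕ.* λ′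
    size≡3+4λ = ℤ.+-injective (begin
      + size                              ≡⟨ size≡2k+1 ⟩
      + 2 * + k + 1ℤ                      ≡⟨ cong (λ n → + 2 * n + 1ℤ) k≡1+2λ ⟩
      + 2 * (1ℤ + + 2 * + λ′) + 1ℤ        ≡⟨ expand (+ λ′) ⟩
      + 3 + + 4 * + λ′                    ≡⟨ cong (_+_ (+ 3)) (sym (ℤ.pos-* 4 λ′)) ⟩
      + 3 + + (4 ℕ.* λ′)                  ≡⟨ sym (ℤ.pos-+ 3 (4 ℕ.* λ′)) ⟩
      + (3 ℕ.+ 4 ℕ.* λ′)                  ∎)
      where open ≡-Reasoning
            expand : ∀ l → + 2 * (1ℤ + + 2 * l) + 1ℤ ≡ + 3 + + 4 * l
            expand = solve-∀

module TwinFieldConstruction (F K : FiniteField) {E : Carrier F → Set} (skew : IsSkewHadamard F E)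
                             (size-K : FiniteField.size K ≡ FiniteField.size F ℕ.+ 2) where
  open import Data.Integer using (_+_; _*_; -_; _-_)
  open FiniteSums
  open Correlations
  open FiniteFields
  open SkewHadamardSets

  private
    module 𝔽  = Correlation (additiveGroup F)
    module 𝕂  = Correlation (additiveGroup K)
    module 𝔽𝕂 = Correlation (additiveGroup F ×ᴳ additiveGroup K)
    module SH = SkewHadamard F skew
  open SH using (ψ; ψ-view; in-E; in-−E; zero)
  open FiniteField K using (χ)
  open Tensor (additiveGroup F) (additiveGroup K)

  t : ℕ
  t = SH.λ′

  size-K≡5+4t : FiniteField.size K ≡ 1 ℕ.+ 4 ℕ.* suc t
  size-K≡5+4t = trans size-K (trans (cong (ℕ._+ 2) SH.size≡3+4λ) (rearrange t))
    where rearrange : ∀ t → 3 ℕ.+ 4 ℕ.* t ℕ.+ 2 ≡ 1 ℕ.+ 4 ℕ.* suc t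
          rearrange = ℕ-Solver.solve-∀

  private
    module χ = QuadraticCharacter K {2 ℕ.* suc t} (trans size-K≡5+4t (cong (1 ℕ.+_) (ℕ.*-assoc 2 2 (suc t))))

  D? : Decidable (Dset F K E)
  D? (x , y) = (SH.E? x ×-dec ¬? (y 𝕂.≟ 𝕂.ε) ×-dec (χ y ℤ.≟ 1ℤ))
            ⊎-dec (SH.NegSet? x ×-dec ¬? (y 𝕂.≟ 𝕂.ε) ×-dec (χ y ℤ.≟ -1ℤ))
            ⊎-dec (y 𝕂.≟ 𝕂.ε)

  sign-D : FiniteField.Carrier F × FiniteField.Carrier K → ℤ
  sign-D p = + 2 * 𝟙 (D? p) + -1ℤ

  private
    q m : ℤ
    q = + FiniteField.size F
    m = + FiniteField.size K

    m≡q+2 : m ≡ q + + 2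
    m≡q+2 = trans (cong +_ size-K) (ℤ.pos-+ (FiniteField.size F) 2)

    𝟏 : FiniteField.Carrier F → ℤ
    𝟏 _ = 1ℤ

    ν : FiniteField.Carrier K → ℤ
    ν y = 𝕂.δ y - 1ℤ

  A B C : FiniteField.Carrier F × FiniteField.Carrier K → ℤ
  A = 𝟏 ⊗ 𝕂.δ
  B = 𝔽.δ ⊗ ν
  C = ψ ⊗ χ

  private
    nonsquare⇒nonzero : ∀ {y} → ¬ FiniteField.IsSquare K y → y ≢ 𝕂.ε
    nonsquare⇒nonzero y-nonsq y≡0 = y-nonsq (𝕂.ε , trans (FieldArithmetic.zeroˡ K 𝕂.ε) (sym y≡0))

    outside-D : ∀ {x y} → ¬ E x → ¬ NegSet F E x → y ≢ 𝕂.ε → ¬ Dset F K E (x , y)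
    outside-D ¬Ex _    _   (inj₁ (Ex , _))         = ¬Ex Ex
    outside-D _   ¬-Ex _   (inj₂ (inj₁ (-Ex , _))) = ¬-Ex -Ex
    outside-D _   _    y≢0 (inj₂ (inj₂ y≡0))       = y≢0 y≡0

    by-values : ∀ {x y d dx dy p c} → 𝟙 (D? (x , y)) ≡ d → 𝔽.δ x ≡ dx → 𝕂.δ y ≡ dy → ψ x ≡ p → χ y ≡ c →
                + 2 * d + -1ℤ ≡ 1ℤ * dy + dx * (dy - 1ℤ) + p * c → sign-D (x , y) ≡ A (x , y) + B (x , y) + C (x , y)
    by-values refl refl refl refl refl eq = eq

  sign-D≗A+B+C : ∀ p → sign-D p ≡ A p + B p + C p
  sign-D≗A+B+C (x , y) = by-views (ψ-view x) (χ.χ-view y)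
    where
    by-views : SH.ψ-View x → χ.χ-View y → sign-D (x , y) ≡ A (x , y) + B (x , y) + C (x , y)
    by-views (in-E Ex ¬-Ex ψ≡ δx≡) (χ.zero y≡0) =
      by-values (𝟙-yes (D? (x , y)) (inj₂ (inj₂ y≡0))) δx≡ (𝟙-yes (y 𝕂.≟ 𝕂.ε) y≡0) ψ≡ (χ.χ-zero y≡0) refl
    by-views (in-E Ex ¬-Ex ψ≡ δx≡) (χ.square y≢0 r rr≡y) =
      by-values (𝟙-yes (D? (x , y)) (inj₁ (Ex , y≢0 , χ.χ-square y≢0 (r , rr≡y))))
                δx≡ (𝟙-no (y 𝕂.≟ 𝕂.ε) y≢0) ψ≡ (χ.χ-square y≢0 (r , rr≡y)) refl
    by-views (in-E Ex ¬-Ex ψ≡ δx≡) (χ.nonsquare y-nonsq) =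
      by-values (𝟙-no (D? (x , y)) λ { (inj₁ (_ , _ , χy≡1)) → case trans (sym χy≡1) (χ.χ-nonsquare y-nonsq) of λ ()
                                      ; (inj₂ (inj₁ (-Ex , _))) → ¬-Ex -Ex
                                      ; (inj₂ (inj₂ y≡0)) → nonsquare⇒nonzero y-nonsq y≡0 })
                δx≡ (𝟙-no (y 𝕂.≟ 𝕂.ε) (nonsquare⇒nonzero y-nonsq)) ψ≡ (χ.χ-nonsquare y-nonsq) refl
    by-views (in-−E ¬Ex -Ex ψ≡ δx≡) (χ.zero y≡0) =
      by-values (𝟙-yes (D? (x , y)) (inj₂ (inj₂ y≡0))) δx≡ (𝟙-yes (y 𝕂.≟ 𝕂.ε) y≡0) ψ≡ (χ.χ-zero y≡0) refl
    by-views (in-−E ¬Ex -Ex ψ≡ δx≡) (χ.square y≢0 r rr≡y) =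
      by-values (𝟙-no (D? (x , y)) λ { (inj₁ (Ex , _)) → ¬Ex Ex
                                      ; (inj₂ (inj₁ (_ , _ , χy≡-1))) → case trans (sym χy≡-1) (χ.χ-square y≢0 (r , rr≡y)) of λ ()
                                      ; (inj₂ (inj₂ y≡0)) → y≢0 y≡0 })
                δx≡ (𝟙-no (y 𝕂.≟ 𝕂.ε) y≢0) ψ≡ (χ.χ-square y≢0 (r , rr≡y)) refl
    by-views (in-−E ¬Ex -Ex ψ≡ δx≡) (χ.nonsquare y-nonsq) =
      by-values (𝟙-yes (D? (x , y)) (inj₂ (inj₁ (-Ex , nonsquare⇒nonzero y-nonsq , χ.χ-nonsquare y-nonsq))))
                δx≡ (𝟙-no (y 𝕂.≟ 𝕂.ε) (nonsquare⇒nonzero y-nonsq)) ψ≡ (χ.χ-nonsquare y-nonsq) refl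
    by-views (zero ¬Ex ¬-Ex ψ≡ δx≡) (χ.zero y≡0) =
      by-values (𝟙-yes (D? (x , y)) (inj₂ (inj₂ y≡0))) δx≡ (𝟙-yes (y 𝕂.≟ 𝕂.ε) y≡0) ψ≡ (χ.χ-zero y≡0) refl
    by-views (zero ¬Ex ¬-Ex ψ≡ δx≡) (χ.square y≢0 r rr≡y) =
      by-values (𝟙-no (D? (x , y)) (outside-D ¬Ex ¬-Ex y≢0))
                δx≡ (𝟙-no (y 𝕂.≟ 𝕂.ε) y≢0) ψ≡ (χ.χ-square y≢0 (r , rr≡y)) refl
    by-views (zero ¬Ex ¬-Ex ψ≡ δx≡) (χ.nonsquare y-nonsq) =
      by-values (𝟙-no (D? (x , y)) (outside-D ¬Ex ¬-Ex (nonsquare⇒nonzero y-nonsq)))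
                δx≡ (𝟙-no (y 𝕂.≟ 𝕂.ε) (nonsquare⇒nonzero y-nonsq)) ψ≡ (χ.χ-nonsquare y-nonsq) refl

  private
    module _ (a : FiniteField.Carrier F) where
      corr-𝟏-𝟏 : 𝔽.corr 𝟏 𝟏 a ≡ q
      corr-𝟏-𝟏 = trans (𝔽.corr-1ˡ 𝟏 a) 𝔽.sum-size
      corr-𝟏-δ : 𝔽.corr 𝟏 𝔽.δ a ≡ 1ℤ
      corr-𝟏-δ = trans (𝔽.corr-1ˡ 𝔽.δ a) 𝔽.sum-δ
      corr-𝟏-ψ : 𝔽.corr 𝟏 ψ a ≡ 0ℤ
      corr-𝟏-ψ = trans (𝔽.corr-1ˡ ψ a) SH.sum-ψ
      corr-δ-𝟏 : 𝔽.corr 𝔽.δ 𝟏 a ≡ 1ℤ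
      corr-δ-𝟏 = trans (𝔽.corr-1ʳ 𝔽.δ a) 𝔽.sum-δ
      corr-δ-δ : 𝔽.corr 𝔽.δ 𝔽.δ a ≡ 𝔽.δ a
      corr-δ-δ = trans (𝔽.corr-δˡ 𝔽.δ a) (𝔽.δ-⁻¹ a)
      corr-δ-ψ : 𝔽.corr 𝔽.δ ψ a ≡ - ψ a
      corr-δ-ψ = trans (𝔽.corr-δˡ ψ a) (SH.ψ-⁻¹ a)
      corr-ψ-𝟏 : 𝔽.corr ψ 𝟏 a ≡ 0ℤ
      corr-ψ-𝟏 = trans (𝔽.corr-1ʳ ψ a) SH.sum-ψ
      corr-ψ-δ : 𝔽.corr ψ 𝔽.δ a ≡ ψ a
      corr-ψ-δ = 𝔽.corr-δʳ ψ a

    module _ (b : FiniteField.Carrier K) where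
      corr-δ-δᴷ : 𝕂.corr 𝕂.δ 𝕂.δ b ≡ 𝕂.δ b
      corr-δ-δᴷ = trans (𝕂.corr-δˡ 𝕂.δ b) (𝕂.δ-⁻¹ b)
      corr-δ-νᴷ : 𝕂.corr 𝕂.δ ν b ≡ 𝕂.δ b - 1ℤ
      corr-δ-νᴷ = trans (𝕂.corr-δˡ ν b) (cong (_- 1ℤ) (𝕂.δ-⁻¹ b))
      corr-δ-χᴷ : 𝕂.corr 𝕂.δ χ b ≡ χ b
      corr-δ-χᴷ = trans (𝕂.corr-δˡ χ b) (χ.χ-neg {suc t} size-K≡5+4t b)
      corr-ν-δᴷ : 𝕂.corr ν 𝕂.δ b ≡ 𝕂.δ b - 1ℤ
      corr-ν-δᴷ = 𝕂.corr-δʳ ν b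
      corr-ν-νᴷ : 𝕂.corr ν ν b ≡ 𝕂.δ b - + 2 + m
      corr-ν-νᴷ = begin
        𝕂.corr ν ν b
          ≡⟨ 𝕂.corr-cong affine affine b ⟩
        𝕂.corr (λ y → 1ℤ * 𝕂.δ y + -1ℤ) (λ y → 1ℤ * 𝕂.δ y + -1ℤ) b
          ≡⟨ 𝕂.corr-affine 1ℤ -1ℤ 1ℤ -1ℤ 𝕂.δ 𝕂.δ b ⟩
        1ℤ * 1ℤ * 𝕂.corr 𝕂.δ 𝕂.δ b + 1ℤ * -1ℤ * 𝕂.sum 𝕂.δ + -1ℤ * 1ℤ * 𝕂.sum 𝕂.δ + -1ℤ * -1ℤ * m
          ≡⟨ cong₂ (λ c s → 1ℤ * 1ℤ * c + 1ℤ * -1ℤ * s + -1ℤ * 1ℤ * s + -1ℤ * -1ℤ * m) corr-δ-δᴷ 𝕂.sum-δ ⟩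
        1ℤ * 1ℤ * 𝕂.δ b + 1ℤ * -1ℤ * 1ℤ + -1ℤ * 1ℤ * 1ℤ + -1ℤ * -1ℤ * m
          ≡⟨ simplify (𝕂.δ b) m ⟩
        𝕂.δ b - + 2 + m ∎
        where open ≡-Reasoning
              affine : ∀ y → ν y ≡ 1ℤ * 𝕂.δ y + -1ℤ
              affine y = cong (_- 1ℤ) (sym (ℤ.*-identityˡ (𝕂.δ y)))
              simplify : ∀ d m → 1ℤ * 1ℤ * d + 1ℤ * -1ℤ * 1ℤ + -1ℤ * 1ℤ * 1ℤ + -1ℤ * -1ℤ * m ≡ d - + 2 + m
              simplify = solve-∀
      corr-ν-χᴷ : 𝕂.corr ν χ b ≡ χ b
      corr-ν-χᴷ = trans (𝕂.corr-+ˡ 𝕂.δ (λ _ → -1ℤ) χ b)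
        (trans (cong₂ _+_ corr-δ-χᴷ (trans (𝕂.corr-negˡ (λ _ → 1ℤ) χ b) (cong -_ (trans (𝕂.corr-1ˡ χ b) χ.sum-χ))))
               (ℤ.+-identityʳ (χ b)))
      corr-χ-δᴷ : 𝕂.corr χ 𝕂.δ b ≡ χ b
      corr-χ-δᴷ = 𝕂.corr-δʳ χ b
      corr-χ-νᴷ : 𝕂.corr χ ν b ≡ χ b
      corr-χ-νᴷ = trans (𝕂.corr-+ʳ χ 𝕂.δ (λ _ → -1ℤ) b)
        (trans (cong₂ _+_ corr-χ-δᴷ (trans (𝕂.corr-negʳ χ (λ _ → 1ℤ) b) (cong -_ (trans (𝕂.corr-1ʳ χ b) χ.sum-χ))))
               (ℤ.+-identityʳ (χ b)))

    module _ (a : FiniteField.Carrier F) (b : FiniteField.Carrier K) where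
      S : FiniteField.Carrier F × FiniteField.Carrier K → ℤ
      S p = A p + B p + C p

      row : ∀ X → 𝔽𝕂.corr X S (a , b) ≡ 𝔽𝕂.corr X A (a , b) + 𝔽𝕂.corr X B (a , b) + 𝔽𝕂.corr X C (a , b)
      row X = trans (𝔽𝕂.corr-+ʳ X (λ p → A p + B p) C (a , b)) (cong (_+ 𝔽𝕂.corr X C (a , b)) (𝔽𝕂.corr-+ʳ X A B (a , b)))

      rowA : 𝔽𝕂.corr A S (a , b) ≡ q * 𝕂.δ b + 1ℤ * (𝕂.δ b - 1ℤ) + 0ℤ * χ b
      rowA = trans (row A) (cong₂ _+_ (cong₂ _+_
        (trans (corr-⊗ 𝟏 𝟏 𝕂.δ 𝕂.δ a b) (cong₂ _*_ (corr-𝟏-𝟏 a) (corr-δ-δᴷ b)))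
        (trans (corr-⊗ 𝟏 𝔽.δ 𝕂.δ ν a b) (cong₂ _*_ (corr-𝟏-δ a) (corr-δ-νᴷ b))))
        (trans (corr-⊗ 𝟏 ψ 𝕂.δ χ a b) (cong₂ _*_ (corr-𝟏-ψ a) (corr-δ-χᴷ b))))

      rowB : 𝔽𝕂.corr B S (a , b) ≡ 1ℤ * (𝕂.δ b - 1ℤ) + 𝔽.δ a * (𝕂.δ b - + 2 + m) + - ψ a * χ b
      rowB = trans (row B) (cong₂ _+_ (cong₂ _+_
        (trans (corr-⊗ 𝔽.δ 𝟏 ν 𝕂.δ a b) (cong₂ _*_ (corr-δ-𝟏 a) (corr-ν-δᴷ b)))
        (trans (corr-⊗ 𝔽.δ 𝔽.δ ν ν a b) (cong₂ _*_ (corr-δ-δ a) (corr-ν-νᴷ b))))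
        (trans (corr-⊗ 𝔽.δ ψ ν χ a b) (cong₂ _*_ (corr-δ-ψ a) (corr-ν-χᴷ b))))

      rowC : 𝔽𝕂.corr C S (a , b) ≡ 0ℤ * χ b + ψ a * χ b + (q * 𝔽.δ a - 1ℤ) * (m * 𝕂.δ b - 1ℤ)
      rowC = trans (row C) (cong₂ _+_ (cong₂ _+_
        (trans (corr-⊗ ψ 𝟏 χ 𝕂.δ a b) (cong₂ _*_ (corr-ψ-𝟏 a) (corr-χ-δᴷ b)))
        (trans (corr-⊗ ψ 𝔽.δ χ ν a b) (cong₂ _*_ (corr-ψ-δ a) (corr-χ-νᴷ b))))
        (trans (corr-⊗ ψ ψ χ χ a b) (cong₂ _*_ (SH.corr-ψ a) (χ.corr-χ b))))

  corr-sign-D : ∀ a b → 𝔽𝕂.corr sign-D sign-D (a , b) ≡ -1ℤ + 𝔽.δ a * 𝕂.δ b * ((q + 1ℤ) * (q + 1ℤ))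
  corr-sign-D a b = begin
    𝔽𝕂.corr sign-D sign-D (a , b)
      ≡⟨ 𝔽𝕂.corr-cong sign-D≗A+B+C sign-D≗A+B+C (a , b) ⟩
    𝔽𝕂.corr (S a b) (S a b) (a , b)
      ≡⟨ trans (𝔽𝕂.corr-+ˡ (λ p → A p + B p) C (S a b) (a , b)) (cong (_+ 𝔽𝕂.corr C (S a b) (a , b)) (𝔽𝕂.corr-+ˡ A B (S a b) (a , b))) ⟩
    𝔽𝕂.corr A (S a b) (a , b) + 𝔽𝕂.corr B (S a b) (a , b) + 𝔽𝕂.corr C (S a b) (a , b)
      ≡⟨ cong₂ _+_ (cong₂ _+_ (rowA a b) (rowB a b)) (rowC a b) ⟩
    (q * δb + 1ℤ * (δb - 1ℤ) + 0ℤ * χb) + (1ℤ * (δb - 1ℤ) + δa * (δb - + 2 + m) + - ψa * χb)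
      + (0ℤ * χb + ψa * χb + (q * δa - 1ℤ) * (m * δb - 1ℤ))
      ≡⟨ cong (λ m → (q * δb + 1ℤ * (δb - 1ℤ) + 0ℤ * χb) + (1ℤ * (δb - 1ℤ) + δa * (δb - + 2 + m) + - ψa * χb)
                      + (0ℤ * χb + ψa * χb + (q * δa - 1ℤ) * (m * δb - 1ℤ))) m≡q+2 ⟩
    (q * δb + 1ℤ * (δb - 1ℤ) + 0ℤ * χb) + (1ℤ * (δb - 1ℤ) + δa * (δb - + 2 + (q + + 2)) + - ψa * χb)
      + (0ℤ * χb + ψa * χb + (q * δa - 1ℤ) * ((q + + 2) * δb - 1ℤ))
      ≡⟨ collect q δa δb ψa χb ⟩
    -1ℤ + δa * δb * ((q + 1ℤ) * (q + 1ℤ)) ∎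
    where
      open ≡-Reasoning
      δa ψa δb χb : ℤ
      δa = 𝔽.δ a
      ψa = ψ a
      δb = 𝕂.δ b
      χb = χ b
      collect : ∀ q da db pa cb →
        (q * db + 1ℤ * (db - 1ℤ) + 0ℤ * cb) + (1ℤ * (db - 1ℤ) + da * (db - + 2 + (q + + 2)) + - pa * cb)
          + (0ℤ * cb + pa * cb + (q * da - 1ℤ) * ((q + + 2) * db - 1ℤ))
        ≡ -1ℤ + da * db * ((q + 1ℤ) * (q + 1ℤ))
      collect = solve-∀

  sum-sign-D : 𝔽𝕂.sum sign-D ≡ -1ℤ
  sum-sign-D = begin
    𝔽𝕂.sum sign-D                             ≡⟨ ∑-cong 𝔽𝕂.elements sign-D≗A+B+C ⟩
    𝔽𝕂.sum (λ p → A p + B p + C p)            ≡⟨ trans (∑-+ 𝔽𝕂.elements (λ p → A p + B p) C) (cong (_+ 𝔽𝕂.sum C) (∑-+ 𝔽𝕂.elements A B)) ⟩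
    𝔽𝕂.sum A + 𝔽𝕂.sum B + 𝔽𝕂.sum C            ≡⟨ cong₂ _+_ (cong₂ _+_ (sum-⊗ 𝟏 𝕂.δ) (sum-⊗ 𝔽.δ ν)) (sum-⊗ ψ χ) ⟩
    𝔽.sum 𝟏 * 𝕂.sum 𝕂.δ + 𝔽.sum 𝔽.δ * 𝕂.sum ν + 𝔽.sum ψ * 𝕂.sum χ
      ≡⟨ cong₂ _+_ (cong₂ _+_ (cong₂ _*_ 𝔽.sum-size 𝕂.sum-δ)
                              (cong₂ _*_ 𝔽.sum-δ (trans (∑-- 𝕂.elements 𝕂.δ (λ _ → 1ℤ)) (cong₂ _-_ 𝕂.sum-δ 𝕂.sum-size))))
                   (cong₂ _*_ SH.sum-ψ χ.sum-χ) ⟩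
    q * 1ℤ + 1ℤ * (1ℤ - m) + 0ℤ * 0ℤ           ≡⟨ cong (λ m → q * 1ℤ + 1ℤ * (1ℤ - m) + 0ℤ * 0ℤ) m≡q+2 ⟩
    q * 1ℤ + 1ℤ * (1ℤ - (q + + 2)) + 0ℤ * 0ℤ   ≡⟨ cancel q ⟩
    -1ℤ                                       ∎
    where open ≡-Reasoning
          cancel : ∀ q → q * 1ℤ + 1ℤ * (1ℤ - (q + + 2)) + 0ℤ * 0ℤ ≡ -1ℤ
          cancel = solve-∀

  n : ℕ
  n = 4 ℕ.* suc t ℕ.* suc t

  [q+1]²/4≡n : (FiniteField.size F ℕ.+ 1) ℕ.* (FiniteField.size F ℕ.+ 1) ℕ./ 4 ≡ n
  [q+1]²/4≡n = trans (cong (λ q → (q ℕ.+ 1) ℕ.* (q ℕ.+ 1) ℕ./ 4) SH.size≡3+4λ)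
                     (trans (cong (ℕ._/ 4) (square t)) (m*n/n≡m n 4))
    where square : ∀ t → (3 ℕ.+ 4 ℕ.* t ℕ.+ 1) ℕ.* (3 ℕ.+ 4 ℕ.* t ℕ.+ 1) ≡ 4 ℕ.* suc t ℕ.* suc t ℕ.* 4
          square = ℕ-Solver.solve-∀

  private
    N : ℤ
    N = + n

    +[k∸1] : ∀ k → 1 ℕ.≤ k → + (k ℕ.∸ 1) ≡ + k - 1ℤ
    +[k∸1] k 1≤k = sym (trans (ℤ.m-n≡m⊖n k 1) (ℤ.⊖-≥ 1≤k))

    +[c*n∸1] : ∀ c → 1 ℕ.≤ c ℕ.* n → + (c ℕ.* n ℕ.∸ 1) ≡ + c * N - 1ℤ
    +[c*n∸1] c 1≤cn = trans (+[k∸1] (c ℕ.* n) 1≤cn) (cong (_- 1ℤ) (ℤ.pos-* c n))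

    eD : FiniteField.Carrier F × FiniteField.Carrier K → ℤ
    eD p = 𝟙 (D? p)

    size-F×K : + 𝔽𝕂.size ≡ + 4 * N - 1ℤ
    size-F×K = begin
      + 𝔽𝕂.size                                 ≡⟨ sym 𝔽𝕂.sum-size ⟩
      𝔽𝕂.sum (𝟏 ⊗ (λ _ → 1ℤ))                  ≡⟨ sum-⊗ 𝟏 (λ _ → 1ℤ) ⟩
      𝔽.sum 𝟏 * 𝕂.sum (λ _ → 1ℤ)                ≡⟨ cong₂ _*_ (trans 𝔽.sum-size q≡3+4t) (trans 𝕂.sum-size (trans m≡q+2 (cong (_+ + 2) q≡3+4t))) ⟩
      (+ 3 + + 4 * + t) * (+ 3 + + 4 * + t + + 2) ≡⟨ expand (+ t) ⟩
      + 4 * (+ 4 * (1ℤ + + t) * (1ℤ + + t)) - 1ℤ  ≡⟨ cong (λ k → + 4 * k - 1ℤ) (sym N≡4[1+t]²) ⟩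
      + 4 * N - 1ℤ                              ∎
      where
        open ≡-Reasoning
        q≡3+4t : q ≡ + 3 + + 4 * + t
        q≡3+4t = trans (cong +_ SH.size≡3+4λ) (trans (ℤ.pos-+ 3 (4 ℕ.* t)) (cong (_+_ (+ 3)) (ℤ.pos-* 4 t)))
        N≡4[1+t]² : N ≡ + 4 * (1ℤ + + t) * (1ℤ + + t)
        N≡4[1+t]² = trans (ℤ.pos-* (4 ℕ.* suc t) (suc t))
          (cong₂ _*_ (trans (ℤ.pos-* 4 (suc t)) (cong (+ 4 *_) (ℤ.pos-+ 1 t))) (ℤ.pos-+ 1 t))
        expand : ∀ t → (+ 3 + + 4 * t) * (+ 3 + + 4 * t + + 2) ≡ + 4 * (+ 4 * (1ℤ + t) * (1ℤ + t)) - 1ℤ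
        expand = solve-∀

    size-D : 𝔽𝕂.sum eD ≡ + 2 * N - 1ℤ
    size-D = ℤ.*-cancelˡ-≡ (+ 2) _ _ (begin
      + 2 * 𝔽𝕂.sum eD                                ≡⟨ shift (𝔽𝕂.sum eD) (+ 𝔽𝕂.size) ⟩
      + 2 * 𝔽𝕂.sum eD + -1ℤ * + 𝔽𝕂.size + + 𝔽𝕂.size  ≡⟨ cong (_+ + 𝔽𝕂.size) (sym sum-sign) ⟩
      𝔽𝕂.sum sign-D + + 𝔽𝕂.size                      ≡⟨ cong₂ _+_ sum-sign-D size-F×K ⟩
      -1ℤ + (+ 4 * N - 1ℤ)                           ≡⟨ halve N ⟩
      + 2 * (+ 2 * N - 1ℤ)                           ∎)
      where
        open ≡-Reasoning
        sum-sign : 𝔽𝕂.sum sign-D ≡ + 2 * 𝔽𝕂.sum eD + -1ℤ * + 𝔽𝕂.size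
        sum-sign = trans (∑-+ 𝔽𝕂.elements (λ p → + 2 * eD p) (λ _ → -1ℤ))
          (cong₂ _+_ (∑-*ˡ 𝔽𝕂.elements (+ 2) eD) (trans (∑-*ˡ 𝔽𝕂.elements -1ℤ (λ _ → 1ℤ)) (cong (-1ℤ *_) 𝔽𝕂.sum-size)))
        shift : ∀ s v → + 2 * s ≡ + 2 * s + -1ℤ * v + v
        shift = solve-∀
        halve : ∀ n → -1ℤ + (+ 4 * n - 1ℤ) ≡ + 2 * (+ 2 * n - 1ℤ)
        halve = solve-∀

    differences : ∀ {g} → g ≢ 𝔽𝕂.ε → 𝔽𝕂.corr eD eD g ≡ N - 1ℤ
    differences {a , b} g≢0 = ℤ.*-cancelˡ-≡ (+ 4) _ _ (begin
      + 4 * 𝔽𝕂.corr eD eD (a , b)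
        ≡⟨ unfold (𝔽𝕂.corr eD eD (a , b)) (𝔽𝕂.sum eD) (+ 𝔽𝕂.size) ⟩
      (+ 4 * 𝔽𝕂.corr eD eD (a , b) - + 4 * 𝔽𝕂.sum eD + + 𝔽𝕂.size) + + 4 * 𝔽𝕂.sum eD - + 𝔽𝕂.size
        ≡⟨ cong (λ c → c + + 4 * 𝔽𝕂.sum eD - + 𝔽𝕂.size) (sym (𝔽𝕂.corr-sign eD (a , b))) ⟩
      𝔽𝕂.corr sign-D sign-D (a , b) + + 4 * 𝔽𝕂.sum eD - + 𝔽𝕂.size
        ≡⟨ cong₂ (λ c s → c + + 4 * s - + 𝔽𝕂.size) (trans (corr-sign-D a b) off-origin) size-D ⟩
      -1ℤ + + 4 * (+ 2 * N - 1ℤ) - + 𝔽𝕂.size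
        ≡⟨ cong (λ v → -1ℤ + + 4 * (+ 2 * N - 1ℤ) - v) size-F×K ⟩
      -1ℤ + + 4 * (+ 2 * N - 1ℤ) - (+ 4 * N - 1ℤ)
        ≡⟨ quarter N ⟩
      + 4 * (N - 1ℤ) ∎)
      where
        open ≡-Reasoning
        off-origin : -1ℤ + 𝔽.δ a * 𝕂.δ b * ((q + 1ℤ) * (q + 1ℤ)) ≡ -1ℤ
        off-origin with a 𝔽.≟ 𝔽.ε
        ... | no _    = refl
        ... | yes a≡0 = cong (λ d → -1ℤ + 1ℤ * d * ((q + 1ℤ) * (q + 1ℤ)))
                             (𝟙-no (b 𝕂.≟ 𝕂.ε) (λ b≡0 → g≢0 (cong₂ _,_ a≡0 b≡0)))
        unfold : ∀ c s v → + 4 * c ≡ (+ 4 * c - + 4 * s + v) + + 4 * s - v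
        unfold = solve-∀
        quarter : ∀ n → -1ℤ + + 4 * (+ 2 * n - 1ℤ) - (+ 4 * n - 1ℤ) ≡ + 4 * (n - 1ℤ)
        quarter = solve-∀

  isDifferenceSet : IsDifferenceSet (prodSub F K) (prodZero F K) (Dset F K E) (4 ℕ.* n ℕ.∸ 1) (2 ℕ.* n ℕ.∸ 1) (n ℕ.∸ 1)
  isDifferenceSet =
    𝔽𝕂.hasSize (λ _ → yes tt) (trans 𝔽𝕂.sum-size (trans size-F×K (sym (+[c*n∸1] 4 (ℕ.s≤s ℕ.z≤n))))) ,
    𝔽𝕂.hasSize D? (trans size-D (sym (+[c*n∸1] 2 (ℕ.s≤s ℕ.z≤n)))) ,
    λ g g≢0 → Equivalence.from (𝔽𝕂.hasSize-differences⇔ D? g≢0) (trans (differences g≢0) (sym (+[k∸1] n (ℕ.s≤s ℕ.z≤n))))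

open import Data.Nat using (_+_; _*_; _∸_; _%_; _/_)

theorem5p2 : (q : ℕ) → IsPrimePower q → IsPrimePower (q + 2) → q % 4 ≡ 3 →
    (F K : FiniteField) → FiniteField.size F ≡ q → FiniteField.size K ≡ q + 2 →
    (E : Carrier F → Set) → IsSkewHadamard F E →
    let n = ((q + 1) * (q + 1)) / 4 in
    IsDifferenceSet (prodSub F K) (prodZero F K) (Dset F K E)
      (4 * n ∸ 1) (2 * n ∸ 1) (n ∸ 1)
-- The prime-power hypotheses only say that the fields exist, and q ≡ 3 (mod 4) is forced by the skew
-- Hadamard difference set (SkewHadamard.size≡3+4λ), so none of them is needed.
theorem5p2 q _ _ _ F K refl size-K E skew =
  subst (λ n → IsDifferenceSet (prodSub F K) (prodZero F K) (Dset F K E) (4 * n ∸ 1) (2 * n ∸ 1) (n ∸ 1))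
        (sym [q+1]²/4≡n) isDifferenceSet
  where open TwinFieldConstruction F K skew size-K using ([q+1]²/4≡n; isDifferenceSet)
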